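{- For every positive integer $N$ and every index $\boldsymbol{k}$, $F_N(\boldsymbol{k};t)=G_N(\boldsymbol{k}^{\vee};t)$ in $\mathbb{Q}(t)$.
   Context: $t$ is an indeterminate, $[n]=\{1,\dots,n\}$. An index is a tuple of positive integers. For an index $\boldsymbol{k}=(k_1,\dots,k_r)$ and $A\subset[r]$, let $\overline{S}_{r,N}(A)$ be the set of $(n_1,\dots,n_r)\in[N-1]^r$ such that $n_{i-1}\le n_i$ for $1<i\in[r]\setminus A$ and $n_{i-1}<n_i$ for $1<i\in A$. Define \[ F_N(\boldsymbol{k};t)=\sum_{A\subset[r]}(-1)^{\#A}\sum_{(n_i)\in\overline{S}_{r,N}(A)}\prod_{i\in A}\frac{1}{(N-n_i+t)^{k_i}}\prod_{i\in[r]\setminus A}\frac{1}{n_i^{k_i}}. \] Let $[r]^1_{\boldsymbol{k}}=\{i\in[r]\mid k_i=1\}$ and for $A\subset[r]$ let $S^{\star}_{r,N}(A)$ be the set of $(n_1,\dots,n_r)\in[N-1]^r$ such that, for $i\in[r-1]$, $n_i\le n_{i+1}$ if $i\in A$ or $i+1\notin A$, and $n_i<n_{i+1}$ if $i\notin A$ and $i+1\in A$. Define \[ G_N(\boldsymbol{k};t)=\sum_{A\subset[r]^1_{\boldsymbol{k}}\setminus\{r\}}\sum_{(n_i)\in S^{\star}_{r,N}(A)}\prod_{i\in A}\frac{1}{N-n_i+t}\prod_{i\in[r]\setminus A}\frac{1}{n_i^{k_i}}\cdot(-1)^{n_r-1}\binom{t}{n_r}\frac{(1-N)_{n_r}}{(1-N-t)_{n_r}},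 \] where $(a)_n=a(a+1)\cdots(a+n-1)$ and $\binom{t}{n}=t(t-1)\cdots(t-n+1)/n!$. The Hoffman dual $\boldsymbol{k}^{\vee}$ of $\boldsymbol{k}$: write $\boldsymbol{k}$ as $(1\,\square\,1\,\square\cdots\square\,1)$ with $k_1+\cdots+k_r$ ones, where the $k_1-1$ first boxes are "$+$", then a ",", then $k_2-1$ boxes "$+$", etc.; $\boldsymbol{k}^{\vee}$ is the index obtained by interchanging "$+$" and "," in every box. -}

module Defs where

open import Data.Bool using (Bool; true; false; not; if_then_else_; _∧_)
open import Data.Nat as ℕ using (ℕ; zero; suc; _∸_; _≡ᵇ_; _<ᵇ_)
open import Data.Integer using (+_)
open import Data.List using (List; []; _∷_; [_]; map; concatMap; replicate; _++_; foldr; upTo; length)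
open import Data.Rational using (ℚ; 0ℚ; 1ℚ; _+_; _*_; _-_; -_; 1/_; ≢-nonZero)
open import Data.Rational.Properties using (_≟_)
open import Relation.Nullary using (yes; no)

ℕ→ℚ : ℕ → ℚ
ℕ→ℚ n = + n Data.Rational./ 1

-- totalised inverse: inv q = 1/q for q ≠ 0 (and 0 for q = 0; this
-- case never arises under the hypotheses of the theorem)
inv : ℚ → ℚ
inv q with q ≟ 0ℚ
... | yes _ = 0ℚ
... | no q≢0 = 1/_ q {{≢-nonZero q≢0}}

_^_ : ℚ → ℕ → ℚ
q ^ zero  = 1ℚ
q ^ suc n = q * (q ^ n)

Σℚ : List ℚ → ℚ
Σℚ = foldr _+_ 0ℚ

Πℚ : List ℚ → ℚ
Πℚ = foldr _*_ 1ℚ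

poch : ℚ → ℕ → ℚ
poch a n = Πℚ (map (λ j → a + ℕ→ℚ j) (upTo n))

factorialℚ : ℕ → ℚ
factorialℚ n = Πℚ (map (λ j → ℕ→ℚ (suc j)) (upTo n))

binom : ℚ → ℕ → ℚ
binom t n = Πℚ (map (λ j → t - ℕ→ℚ j) (upTo n)) * inv (factorialℚ n)

-- an index is a list of positive integers (positivity is a hypothesis
-- of the theorem)
Index : Set
Index = List ℕ

-- all subsets A of [r], as characteristic lists (a_1,...,a_r), a_i = (i ∈ A)
subsets : ℕ → List (List Bool)
subsets zero    = [ [] ]
subsets (suc r) = concatMap (λ b → map (b ∷_) (subsets r)) (true ∷ false ∷ [])

tuples : ℕ → ℕ → List (List ℕ)
tuples N zero    = [ [] ]
tuples N (suc r) = concatMap (λ n → map (n ∷_) (tuples N r)) (map suc (upTo (N ∸ 1)))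

_≤ᵇ_ : ℕ → ℕ → Bool
m ≤ᵇ n = m <ᵇ suc n

-- membership of (n_i) in S̄_{r,N}(A): for 1 < i ≤ r,
-- n_{i-1} < n_i if i ∈ A, n_{i-1} ≤ n_i otherwise
inSbar : List Bool → List ℕ → Bool
inSbar (_ ∷ a₂ ∷ as) (n₁ ∷ n₂ ∷ ns) =
  (if a₂ then n₁ <ᵇ n₂ else n₁ ≤ᵇ n₂) ∧ inSbar (a₂ ∷ as) (n₂ ∷ ns)
inSbar _ _ = true

-- membership of (n_i) in S*_{r,N}(A): for 1 ≤ i < r,
-- n_i < n_{i+1} if i ∉ A and i+1 ∈ A, n_i ≤ n_{i+1} otherwise
inSstar : List Bool → List ℕ → Bool
inSstar (a₁ ∷ a₂ ∷ as) (n₁ ∷ n₂ ∷ ns) =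
  (if not a₁ ∧ a₂ then n₁ <ᵇ n₂ else n₁ ≤ᵇ n₂) ∧ inSstar (a₂ ∷ as) (n₂ ∷ ns)
inSstar _ _ = true

-- A ⊂ [r]^1_k \ {r}: every i ∈ A has k_i = 1 and i ≠ r
admissible : List Bool → Index → Bool
admissible (a ∷ []) (k ∷ []) = not a
admissible (a ∷ as) (k ∷ ks) = (if a then k ≡ᵇ 1 else true) ∧ admissible as ks
admissible _ _ = true

card : List Bool → ℕ
card [] = 0
card (true ∷ as) = suc (card as)
card (false ∷ as) = card as

last : List ℕ → ℕ
last [] = 0
last (n ∷ []) = n
last (n ∷ ns) = last ns

zipW : {A B C : Set} → (A → B → C) → List A → List B → List C
zipW f (a ∷ as) (b ∷ bs) = f a b ∷ zipW f as bs
zipW f _ _ = []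

zip3 : {A B C D : Set} → (A → B → C → D) → List A → List B → List C → List D
zip3 f (a ∷ as) (b ∷ bs) (c ∷ cs) = f a b c ∷ zip3 f as bs cs
zip3 f _ _ _ = []

sign : ℕ → ℚ
sign zero = 1ℚ
sign (suc n) = - sign n

F : ℕ → Index → ℚ → ℚ
F N k t =
  Σℚ (map (λ A →
    sign (card A) *
    Σℚ (map (λ ns →
      if inSbar A ns
      then Πℚ (zip3 (λ a kᵢ nᵢ →
                 if a then inv (ℕ→ℚ (N ∸ nᵢ) + t) ^ kᵢ
                      else inv (ℕ→ℚ nᵢ) ^ kᵢ) A k ns)
      else 0ℚ)
      (tuples N r)))
    (subsets r))
  where r = length k

G : ℕ → Index → ℚ → ℚ
G N k t =
  Σℚ (map (λ A →
    if admissible A k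
    then Σℚ (map (λ ns →
      if inSstar A ns
      then Πℚ (zip3 (λ a kᵢ nᵢ →
                 if a then inv (ℕ→ℚ (N ∸ nᵢ) + t)
                      else inv (ℕ→ℚ nᵢ ^ kᵢ)) A k ns)
           * (sign (last ns ∸ 1) * binom t (last ns)
              * (poch (1ℚ - ℕ→ℚ N) (last ns)
                 * inv (poch (1ℚ - ℕ→ℚ N - t) (last ns))))
      else 0ℚ)
      (tuples N r))
    else 0ℚ)
    (subsets r))
  where r = length k

-- k = (1 □ 1 □ ... □ 1); boxes: true = "+", false = ","
toBoxes : Index → List Bool
toBoxes [] = []
toBoxes (k ∷ []) = replicate (k ∸ 1) true
toBoxes (k ∷ ks@(_ ∷ _)) = replicate (k ∸ 1) true ++ (false ∷ toBoxes ks)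

fromBoxes : ℕ → List Bool → Index
fromBoxes c [] = [ c ]
fromBoxes c (true ∷ bs) = fromBoxes (suc c) bs
fromBoxes c (false ∷ bs) = c ∷ fromBoxes 1 bs

dual : Index → Index
dual k = fromBoxes 1 (map not (toBoxes k))

module Submission where

open import Defs
open import Data.Bool using (Bool; true; false; not; if_then_else_; _∧_)
open import Data.Empty using (⊥-elim)
import Data.Integer as ℤ
import Data.Integer.Properties as ℤₚ
open import Data.List using (List; []; _∷_; [_]; map; concatMap; _++_; upTo; applyUpTo; replicate; length; _∷ʳ_)
import Data.List.Properties as List
open import Data.List.Relation.Unary.All using (All; _∷_)
open import Data.Nat as ℕ using (ℕ; zero; suc; pred; _∸_; _≤_; _<_; z≤n; s≤s; _<ᵇ_; _≡ᵇ_)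
import Data.Nat.Properties as ℕₚ
import Data.Nat.Coprimality as Coprime
open import Data.Product using (∃₂; _,_)
open import Data.Rational using (ℚ; 0ℚ; 1ℚ; _+_; _*_; _-_; -_; mkℚ; ≢-nonZero; toℚᵘ)
open import Data.Rational.Properties
  using (_≟_; +-*-commutativeRing; toℚᵘ-injective; toℚᵘ-homo-+; normalize-coprime; *-inverseʳ;
         1≢0; +-identityˡ; +-identityʳ; +-inverseʳ; *-identityˡ; *-identityʳ; *-zeroˡ; *-zeroʳ; *-comm; *-assoc;
         *-distribˡ-+; +-assoc; +-comm)
import Data.Rational.Unnormalised as ℚᵘ
import Data.Rational.Unnormalised.Properties as ℚᵘₚ
open import Data.Sum using (inj₁; inj₂)
open import Level using (0ℓ)
open import Relation.Binary.PropositionalEquality hiding ([_])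
open import Relation.Nullary using (yes; no)
open import Relation.Nullary.Decidable using (dec⇒maybe)
open import Tactic.RingSolver using (solve-∀)
open import Tactic.RingSolver.Core.AlmostCommutativeRing using (AlmostCommutativeRing; fromCommutativeRing)

-- Both sides are sums over chains of states (τ, n), 1 ≤ n ≤ N - 1, where τ records membership in A.
-- Reading the box word of k (for F) and of its negation k^∨ (for G) box by box, each side becomes a
-- product of transfer matrices. The proof is a connected-sum argument: for each kind of box b there is a
-- connector D_b from F-states to G-states, built from the hypergeometric kernel Φ, with
-- D_β ∘ T^F_b = T^G_(not β) ∘ D_b and matching boundary conditions at both ends of the word, so the
-- connector can be slid through the word, turning the F-chain into the G-chain one box at a time.
-- Each intertwining relation comes down, after telescoping in n or in m, to a rational identity for Φ.

ringℚ : AlmostCommutativeRing 0ℓ 0ℓ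
ringℚ = fromCommutativeRing +-*-commutativeRing (λ x → dec⇒maybe (0ℚ ≟ x))

ℕ→ℚ-mkℚ : ∀ n → ℕ→ℚ n ≡ mkℚ (ℤ.+ n) 0 (Coprime.sym (Coprime.1-coprimeTo n))
ℕ→ℚ-mkℚ n = normalize-coprime (Coprime.sym (Coprime.1-coprimeTo n))

ℕ→ℚ-suc : ∀ n → ℕ→ℚ (suc n) ≡ 1ℚ + ℕ→ℚ n
ℕ→ℚ-suc n = toℚᵘ-injective (begin
  toℚᵘ (ℕ→ℚ (suc n))            ≡⟨ cong toℚᵘ (ℕ→ℚ-mkℚ (suc n)) ⟩
  ℚᵘ.mkℚᵘ (ℤ.+ suc n) 0         ≈⟨ ℚᵘ.*≡* (cong₂ ℤ._*_ (cong (ℤ._+_ (ℤ.+ 1)) (sym (ℤₚ.*-identityʳ (ℤ.+ n)))) refl) ⟩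
  ℚᵘ.mkℚᵘ (ℤ.+ 1) 0 ℚᵘ.+ ℚᵘ.mkℚᵘ (ℤ.+ n) 0 ≡⟨ cong (λ q → toℚᵘ 1ℚ ℚᵘ.+ toℚᵘ q) (sym (ℕ→ℚ-mkℚ n)) ⟩
  toℚᵘ 1ℚ ℚᵘ.+ toℚᵘ (ℕ→ℚ n)     ≈⟨ ℚᵘₚ.≃-sym (toℚᵘ-homo-+ 1ℚ (ℕ→ℚ n)) ⟩
  toℚᵘ (1ℚ + ℕ→ℚ n)             ∎)
  where open ℚᵘₚ.≃-Reasoning

ℕ→ℚ-+ : ∀ m n → ℕ→ℚ (m ℕ.+ n) ≡ ℕ→ℚ m + ℕ→ℚ n
ℕ→ℚ-+ zero    n = sym (+-identityˡ (ℕ→ℚ n))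
ℕ→ℚ-+ (suc m) n = begin
  ℕ→ℚ (suc (m ℕ.+ n))    ≡⟨ ℕ→ℚ-suc (m ℕ.+ n) ⟩
  1ℚ + ℕ→ℚ (m ℕ.+ n)     ≡⟨ cong (1ℚ +_) (ℕ→ℚ-+ m n) ⟩
  1ℚ + (ℕ→ℚ m + ℕ→ℚ n)   ≡⟨ reassoc (ℕ→ℚ m) (ℕ→ℚ n) ⟩
  (1ℚ + ℕ→ℚ m) + ℕ→ℚ n   ≡⟨ cong (_+ ℕ→ℚ n) (sym (ℕ→ℚ-suc m)) ⟩
  ℕ→ℚ (suc m) + ℕ→ℚ n    ∎
  where
  open ≡-Reasoning
  reassoc : ∀ x y → 1ℚ + (x + y) ≡ (1ℚ + x) + y
  reassoc = solve-∀ ringℚ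

ℕ→ℚ-∸ : ∀ m n → n ≤ m → ℕ→ℚ (m ∸ n) ≡ ℕ→ℚ m - ℕ→ℚ n
ℕ→ℚ-∸ m n n≤m = begin
  ℕ→ℚ (m ∸ n)                     ≡⟨ add-sub (ℕ→ℚ (m ∸ n)) (ℕ→ℚ n) ⟩
  (ℕ→ℚ (m ∸ n) + ℕ→ℚ n) - ℕ→ℚ n   ≡⟨ cong (_- ℕ→ℚ n) (sym (ℕ→ℚ-+ (m ∸ n) n)) ⟩
  ℕ→ℚ (m ∸ n ℕ.+ n) - ℕ→ℚ n       ≡⟨ cong (λ k → ℕ→ℚ k - ℕ→ℚ n) (ℕₚ.m∸n+n≡m n≤m) ⟩
  ℕ→ℚ m - ℕ→ℚ n                   ∎
  where
  open ≡-Reasoning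
  add-sub : ∀ x y → x ≡ (x + y) - y
  add-sub = solve-∀ ringℚ

ℕ→ℚ-suc-1 : ∀ n → ℕ→ℚ (suc n) - 1ℚ ≡ ℕ→ℚ n
ℕ→ℚ-suc-1 n = trans (cong (_- 1ℚ) (ℕ→ℚ-suc n)) (cancel (ℕ→ℚ n))
  where
  cancel : ∀ x → 1ℚ + x - 1ℚ ≡ x
  cancel = solve-∀ ringℚ

ℕ→ℚ-suc≢0 : ∀ n → ℕ→ℚ (suc n) ≢ 0ℚ
ℕ→ℚ-suc≢0 n eq with trans (sym (ℕ→ℚ-mkℚ (suc n))) (trans eq (ℕ→ℚ-mkℚ 0))
... | ()

inv-inverseʳ : ∀ q → q ≢ 0ℚ → q * inv q ≡ 1ℚ
inv-inverseʳ q q≢0 with q ≟ 0ℚ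
... | yes q≡0 = ⊥-elim (q≢0 q≡0)
... | no  q≢0′ = *-inverseʳ q {{≢-nonZero q≢0′}}

inv-inverseˡ : ∀ q → q ≢ 0ℚ → inv q * q ≡ 1ℚ
inv-inverseˡ q q≢0 = trans (*-comm (inv q) q) (inv-inverseʳ q q≢0)

inverse⇒≢0 : ∀ w x → w * x ≡ 1ℚ → x ≢ 0ℚ
inverse⇒≢0 w x wx≡1 x≡0 = 1≢0 (trans (sym wx≡1) (trans (cong (w *_) x≡0) (*-zeroʳ w)))

*-cancelˡ-≢0 : ∀ d x y → d ≢ 0ℚ → d * x ≡ d * y → x ≡ y
*-cancelˡ-≢0 d x y d≢0 eq = begin
  x                ≡⟨ sym (unmultiply x) ⟩
  inv d * (d * x)  ≡⟨ cong (inv d *_) eq ⟩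
  inv d * (d * y)  ≡⟨ unmultiply y ⟩
  y                ∎
  where
  open ≡-Reasoning
  unmultiply : ∀ z → inv d * (d * z) ≡ z
  unmultiply z = begin
    inv d * (d * z)  ≡⟨ sym (*-assoc (inv d) d z) ⟩
    (inv d * d) * z  ≡⟨ cong (_* z) (inv-inverseˡ d d≢0) ⟩
    1ℚ * z           ≡⟨ *-identityˡ z ⟩
    z                ∎

inv-unique : ∀ q x → q ≢ 0ℚ → q * x ≡ 1ℚ → inv q ≡ x
inv-unique q x q≢0 qx≡1 = *-cancelˡ-≢0 q (inv q) x q≢0 (trans (inv-inverseʳ q q≢0) (sym qx≡1))

*-≢0 : ∀ a b → a ≢ 0ℚ → b ≢ 0ℚ → a * b ≢ 0ℚ
*-≢0 a b a≢0 b≢0 ab≡0 = b≢0 (*-cancelˡ-≢0 a b 0ℚ a≢0 (trans ab≡0 (sym (*-zeroʳ a))))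

*≢0⇒≢0ˡ : ∀ a b → a * b ≢ 0ℚ → a ≢ 0ℚ
*≢0⇒≢0ˡ a b ab≢0 refl = ab≢0 (*-zeroˡ b)

*≢0⇒≢0ʳ : ∀ a b → a * b ≢ 0ℚ → b ≢ 0ℚ
*≢0⇒≢0ʳ a b ab≢0 refl = ab≢0 (*-zeroʳ a)

inv-distrib-* : ∀ a b → a ≢ 0ℚ → b ≢ 0ℚ → inv (a * b) ≡ inv a * inv b
inv-distrib-* a b a≢0 b≢0 = inv-unique (a * b) (inv a * inv b) (*-≢0 a b a≢0 b≢0) (begin
  (a * b) * (inv a * inv b)    ≡⟨ interchange a b (inv a) (inv b) ⟩
  (a * inv a) * (b * inv b)    ≡⟨ cong₂ _*_ (inv-inverseʳ a a≢0) (inv-inverseʳ b b≢0) ⟩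
  1ℚ * 1ℚ                      ≡⟨ *-identityˡ 1ℚ ⟩
  1ℚ                           ∎)
  where
  open ≡-Reasoning
  interchange : ∀ x y z w → (x * y) * (z * w) ≡ (x * z) * (y * w)
  interchange = solve-∀ ringℚ

^-≢0 : ∀ x l → x ≢ 0ℚ → x ^ l ≢ 0ℚ
^-≢0 x zero    _   = 1≢0
^-≢0 x (suc l) x≢0 = *-≢0 x (x ^ l) x≢0 (^-≢0 x l x≢0)

inv-^ : ∀ x l → x ≢ 0ℚ → inv (x ^ l) ≡ inv x ^ l
inv-^ x zero    _   = inv-unique 1ℚ 1ℚ 1≢0 (*-identityˡ 1ℚ)
inv-^ x (suc l) x≢0 = trans (inv-distrib-* x (x ^ l) x≢0 (^-≢0 x l x≢0)) (cong (inv x *_) (inv-^ x l x≢0))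

sign-sq : ∀ m → sign m * sign m ≡ 1ℚ
sign-sq zero    = *-identityˡ 1ℚ
sign-sq (suc m) = trans (neg-sq (sign m)) (sign-sq m)
  where
  neg-sq : ∀ s → - s * - s ≡ s * s
  neg-sq = solve-∀ ringℚ

sign≢0 : ∀ m → sign m ≢ 0ℚ
sign≢0 m = inverse⇒≢0 (sign m) (sign m) (sign-sq m)

inv-sign : ∀ m → inv (sign m) ≡ sign m
inv-sign m = inv-unique (sign m) (sign m) (sign≢0 m) (sign-sq m)

<ᵇ-true : ∀ m n → m < n → (m <ᵇ n) ≡ true
<ᵇ-true zero    (suc n) _         = refl
<ᵇ-true (suc m) (suc n) (s≤s m<n) = <ᵇ-true m n m<n

<ᵇ-false : ∀ m n → n ≤ m → (m <ᵇ n) ≡ false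
<ᵇ-false m       zero    _         = refl
<ᵇ-false (suc m) (suc n) (s≤s n≤m) = <ᵇ-false m n n≤m

≤ᵇ-true : ∀ m n → m ≤ n → (m ≤ᵇ n) ≡ true
≤ᵇ-true m n m≤n = <ᵇ-true m (suc n) (s≤s m≤n)

≤ᵇ-false : ∀ m n → n < m → (m ≤ᵇ n) ≡ false
≤ᵇ-false m n = <ᵇ-false m (suc n)

if-+ : ∀ b x y → (if b then x + y else 0ℚ) ≡ (if b then x else 0ℚ) + (if b then y else 0ℚ)
if-+ true  x y = refl
if-+ false x y = sym (+-identityˡ 0ℚ)

sumTo : ℕ → (ℕ → ℚ) → ℚ
sumTo zero    f = 0ℚ
sumTo (suc K) f = sumTo K f + f (suc K)

sumTo-cong : ∀ K (f g : ℕ → ℚ) → (∀ i → 1 ≤ i → i ≤ K → f i ≡ g i) → sumTo K f ≡ sumTo K g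
sumTo-cong zero    f g f≗g = refl
sumTo-cong (suc K) f g f≗g =
  cong₂ _+_ (sumTo-cong K f g (λ i 1≤i i≤K → f≗g i 1≤i (ℕₚ.m≤n⇒m≤1+n i≤K))) (f≗g (suc K) (s≤s z≤n) ℕₚ.≤-refl)

sumTo-zero : ∀ K (f : ℕ → ℚ) → (∀ i → 1 ≤ i → i ≤ K → f i ≡ 0ℚ) → sumTo K f ≡ 0ℚ
sumTo-zero K f f≗0 = trans (sumTo-cong K f (λ _ → 0ℚ) f≗0) (zeros K)
  where
  zeros : ∀ K → sumTo K (λ _ → 0ℚ) ≡ 0ℚ
  zeros zero    = refl
  zeros (suc K) = trans (+-identityʳ (sumTo K (λ _ → 0ℚ))) (zeros K)

sumTo-+ : ∀ K (f g : ℕ → ℚ) → sumTo K (λ i → f i + g i) ≡ sumTo K f + sumTo K g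
sumTo-+ zero    f g = sym (+-identityˡ 0ℚ)
sumTo-+ (suc K) f g =
  trans (cong (_+ (f (suc K) + g (suc K))) (sumTo-+ K f g)) (interchange (sumTo K f) (sumTo K g) (f (suc K)) (g (suc K)))
  where
  interchange : ∀ a b c d → (a + b) + (c + d) ≡ (a + c) + (b + d)
  interchange = solve-∀ ringℚ

sumTo-- : ∀ K (f g : ℕ → ℚ) → sumTo K (λ i → f i - g i) ≡ sumTo K f - sumTo K g
sumTo-- zero    f g = sym (+-identityˡ 0ℚ)
sumTo-- (suc K) f g =
  trans (cong (_+ (f (suc K) - g (suc K))) (sumTo-- K f g)) (interchange (sumTo K f) (sumTo K g) (f (suc K)) (g (suc K)))
  where
  interchange : ∀ a b c d → (a - b) + (c - d) ≡ (a + c) - (b + d)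
  interchange = solve-∀ ringℚ

sumTo-* : ∀ K c (f : ℕ → ℚ) → sumTo K (λ i → c * f i) ≡ c * sumTo K f
sumTo-* zero    c f = sym (*-zeroʳ c)
sumTo-* (suc K) c f = trans (cong (_+ (c * f (suc K))) (sumTo-* K c f)) (sym (*-distribˡ-+ c (sumTo K f) (f (suc K))))

sumTo-swap : ∀ K L (f : ℕ → ℕ → ℚ) →
  sumTo K (λ i → sumTo L (λ j → f i j)) ≡ sumTo L (λ j → sumTo K (λ i → f i j))
sumTo-swap zero    L f = sym (sumTo-zero L (λ _ → 0ℚ) (λ _ _ _ → refl))
sumTo-swap (suc K) L f = trans (cong (_+ sumTo L (λ j → f (suc K) j)) (sumTo-swap K L f))
  (sym (sumTo-+ L (λ j → sumTo K (λ i → f i j)) (λ j → f (suc K) j)))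

sumTo-upTo : ∀ L K (f : ℕ → ℚ) → K ≤ L → sumTo L (λ i → if i ≤ᵇ K then f i else 0ℚ) ≡ sumTo K f
sumTo-upTo zero    zero f _ = refl
sumTo-upTo (suc L) K f K≤1+L with ℕₚ.m≤n⇒m<n∨m≡n K≤1+L
... | inj₁ K<1+L = begin
  sumTo L (λ i → if i ≤ᵇ K then f i else 0ℚ) + (if suc L ≤ᵇ K then f (suc L) else 0ℚ)
    ≡⟨ cong₂ _+_ (sumTo-upTo L K f (ℕₚ.≤-pred K<1+L)) (cong (λ b → if b then f (suc L) else 0ℚ) (≤ᵇ-false (suc L) K K<1+L)) ⟩
  sumTo K f + 0ℚ
    ≡⟨ +-identityʳ (sumTo K f) ⟩
  sumTo K f ∎
  where open ≡-Reasoning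
... | inj₂ refl = cong₂ _+_
  (sumTo-cong L _ f (λ i _ i≤L → cong (λ b → if b then f i else 0ℚ) (≤ᵇ-true i (suc L) (ℕₚ.m≤n⇒m≤1+n i≤L))))
  (cong (λ b → if b then f (suc L) else 0ℚ) (≤ᵇ-true (suc L) (suc L) ℕₚ.≤-refl))

sumTo-telescope : ∀ K (E : ℕ → ℚ) → sumTo K (λ i → E i - E (pred i)) ≡ E K - E 0
sumTo-telescope zero    E = sym (+-inverseʳ (E 0))
sumTo-telescope (suc K) E = trans (cong (_+ (E (suc K) - E K)) (sumTo-telescope K E)) (chain (E K) (E 0) (E (suc K)))
  where
  chain : ∀ a b c → (a - b) + (c - a) ≡ c - b
  chain = solve-∀ ringℚ

sumFrom : ℕ → ℕ → (ℕ → ℚ) → ℚ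
sumFrom m L f = sumTo L (λ i → if m ≤ᵇ i then f i else 0ℚ)

sumFrom-1 : ∀ L (f : ℕ → ℚ) → sumFrom 1 L f ≡ sumTo L f
sumFrom-1 L f = sumTo-cong L _ _ (λ i 1≤i _ → cong (λ b → if b then f i else 0ℚ) (≤ᵇ-true 1 i 1≤i))

sumFrom-empty : ∀ m L (f : ℕ → ℚ) → L < m → sumFrom m L f ≡ 0ℚ
sumFrom-empty m L f L<m =
  sumTo-zero L _ (λ i _ i≤L → cong (λ b → if b then f i else 0ℚ) (≤ᵇ-false m i (ℕₚ.≤-<-trans i≤L L<m)))

sumFrom-zero : ∀ m L (f : ℕ → ℚ) → (∀ i → 1 ≤ i → i ≤ L → f i ≡ 0ℚ) → sumFrom m L f ≡ 0ℚ
sumFrom-zero m L f f≗0 = sumTo-zero L _ (λ i 1≤i i≤L → vanish (m ≤ᵇ i) (f≗0 i 1≤i i≤L))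
  where
  vanish : ∀ {x} b → x ≡ 0ℚ → (if b then x else 0ℚ) ≡ 0ℚ
  vanish true  x≡0 = x≡0
  vanish false _   = refl

sumFrom-cong : ∀ m L (f g : ℕ → ℚ) → (∀ i → m ≤ i → i ≤ L → f i ≡ g i) → sumFrom m L f ≡ sumFrom m L g
sumFrom-cong m L f g f≗g = sumTo-cong L _ _ (λ i _ i≤L → pointwise i i≤L)
  where
  pointwise : ∀ i → i ≤ L → (if m ≤ᵇ i then f i else 0ℚ) ≡ (if m ≤ᵇ i then g i else 0ℚ)
  pointwise i i≤L with ℕₚ.≤-<-connex m i
  ... | inj₁ m≤i rewrite ≤ᵇ-true m i m≤i = f≗g i m≤i i≤L
  ... | inj₂ i<m rewrite ≤ᵇ-false m i i<m = refl

sumFrom-+ : ∀ m L (f g : ℕ → ℚ) → sumFrom m L (λ i → f i + g i) ≡ sumFrom m L f + sumFrom m L g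
sumFrom-+ m L f g = trans (sumTo-cong L _ _ (λ i _ _ → if-+ (m ≤ᵇ i) (f i) (g i))) (sumTo-+ L _ _)

sumFrom-- : ∀ m L (f g : ℕ → ℚ) → sumFrom m L (λ i → f i - g i) ≡ sumFrom m L f - sumFrom m L g
sumFrom-- m L f g = trans (sumTo-cong L _ _ (λ i _ _ → if-- (m ≤ᵇ i) (f i) (g i))) (sumTo-- L _ _)
  where
  if-- : ∀ b x y → (if b then x - y else 0ℚ) ≡ (if b then x else 0ℚ) - (if b then y else 0ℚ)
  if-- true  x y = refl
  if-- false x y = sym (+-inverseʳ 0ℚ)

sumFrom-split : ∀ m L (f : ℕ → ℚ) → 1 ≤ m → m ≤ L → sumFrom m L f ≡ f m + sumFrom (suc m) L f
sumFrom-split (suc m) zero f _ ()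
sumFrom-split m (suc L) f 1≤m m≤1+L with ℕₚ.m≤n⇒m<n∨m≡n m≤1+L
... | inj₁ m<1+L rewrite ≤ᵇ-true m (suc L) (ℕₚ.<⇒≤ m<1+L) | ≤ᵇ-true (suc m) (suc L) m<1+L =
  trans (cong (_+ f (suc L)) (sumFrom-split m L f 1≤m (ℕₚ.≤-pred m<1+L)))
        (+-assoc (f m) (sumFrom (suc m) L f) (f (suc L)))
... | inj₂ refl rewrite ≤ᵇ-true (suc L) (suc L) ℕₚ.≤-refl = begin
  sumFrom (suc L) L f + f (suc L)
    ≡⟨ cong (_+ f (suc L)) (sumFrom-empty (suc L) L f ℕₚ.≤-refl) ⟩
  0ℚ + f (suc L)
    ≡⟨ +-comm 0ℚ (f (suc L)) ⟩
  f (suc L) + 0ℚ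
    ≡⟨ cong (f (suc L) +_) (sym (sumFrom-empty (suc (suc L)) (suc L) f ℕₚ.≤-refl)) ⟩
  f (suc L) + sumFrom (suc (suc L)) (suc L) f ∎
  where open ≡-Reasoning

sumFrom-telescope : ∀ m L (E f : ℕ → ℚ) → 1 ≤ m → m ≤ suc L →
  (∀ i → m ≤ i → i ≤ L → f i ≡ E i - E (suc i)) → sumFrom m L f ≡ E m - E (suc L)
sumFrom-telescope m zero E f 1≤m m≤1 _ with ℕₚ.≤-antisym m≤1 1≤m
... | refl = sym (+-inverseʳ (E 1))
sumFrom-telescope m (suc L) E f 1≤m m≤2+L f≡ΔE with ℕₚ.m≤n⇒m<n∨m≡n m≤2+L
... | inj₁ m<2+L rewrite ≤ᵇ-true m (suc L) (ℕₚ.≤-pred m<2+L) =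
  trans (cong₂ _+_ (sumFrom-telescope m L E f 1≤m (ℕₚ.≤-pred m<2+L) (λ i m≤i i≤L → f≡ΔE i m≤i (ℕₚ.m≤n⇒m≤1+n i≤L)))
                   (f≡ΔE (suc L) (ℕₚ.≤-pred m<2+L) ℕₚ.≤-refl))
        (chain (E m) (E (suc L)) (E (suc (suc L))))
  where
  chain : ∀ a b c → (a - b) + (b - c) ≡ a - c
  chain = solve-∀ ringℚ
... | inj₂ refl = trans (sumFrom-empty (suc (suc L)) (suc L) f ℕₚ.≤-refl) (sym (+-inverseʳ (E (suc (suc L)))))

falling : ℚ → ℕ → ℚ
falling x zero    = 1ℚ
falling x (suc m) = x * falling (x - 1ℚ) m

falling-snoc : ∀ x m → falling x (suc m) ≡ falling x m * (x - ℕ→ℚ m)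
falling-snoc x zero    = trans (*-identityʳ x) (sym (trans (*-identityˡ (x - 0ℚ)) (+-identityʳ x)))
falling-snoc x (suc m) = begin
  x * falling (x - 1ℚ) (suc m)                    ≡⟨ cong (x *_) (falling-snoc (x - 1ℚ) m) ⟩
  x * (falling (x - 1ℚ) m * (x - 1ℚ - ℕ→ℚ m))     ≡⟨ reassoc x (falling (x - 1ℚ) m) (ℕ→ℚ m) ⟩
  (x * falling (x - 1ℚ) m) * (x - (1ℚ + ℕ→ℚ m))   ≡⟨ cong (λ z → (x * falling (x - 1ℚ) m) * (x - z)) (sym (ℕ→ℚ-suc m)) ⟩
  (x * falling (x - 1ℚ) m) * (x - ℕ→ℚ (suc m))    ∎
  where
  open ≡-Reasoning
  reassoc : ∀ x a b → x * (a * (x - 1ℚ - b)) ≡ (x * a) * (x - (1ℚ + b))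
  reassoc = solve-∀ ringℚ

falling-vanish : ∀ K m → K < m → falling (ℕ→ℚ K) m ≡ 0ℚ
falling-vanish zero    (suc m) _         = *-zeroˡ (falling (0ℚ - 1ℚ) m)
falling-vanish (suc K) (suc m) (s≤s K<m) = begin
  ℕ→ℚ (suc K) * falling (ℕ→ℚ (suc K) - 1ℚ) m  ≡⟨ cong (λ z → ℕ→ℚ (suc K) * falling z m) (ℕ→ℚ-suc-1 K) ⟩
  ℕ→ℚ (suc K) * falling (ℕ→ℚ K) m             ≡⟨ cong (ℕ→ℚ (suc K) *_) (falling-vanish K m K<m) ⟩
  ℕ→ℚ (suc K) * 0ℚ                            ≡⟨ *-zeroʳ (ℕ→ℚ (suc K)) ⟩
  0ℚ                                          ∎
  where open ≡-Reasoning

factorial : ℕ → ℚ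
factorial zero    = 1ℚ
factorial (suc m) = factorial m * ℕ→ℚ (suc m)

factorial≢0 : ∀ m → factorial m ≢ 0ℚ
factorial≢0 zero    = 1≢0
factorial≢0 (suc m) = *-≢0 _ _ (factorial≢0 m) (ℕ→ℚ-suc≢0 m)

-- The ring solver cannot use a hypothesis p ≡ 1ℚ: solve with p abstract, then substitute.

at-unit₁ : ∀ {L R : ℚ} (F : ℚ → ℚ) {p} → L ≡ F p → p ≡ 1ℚ → F 1ℚ ≡ R → L ≡ R
at-unit₁ F L≡Fp refl F1≡R = trans L≡Fp F1≡R

at-unit₂ : ∀ {L R : ℚ} (F : ℚ → ℚ → ℚ) {p q} → L ≡ F p q → p ≡ 1ℚ → q ≡ 1ℚ → F 1ℚ 1ℚ ≡ R → L ≡ R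
at-unit₂ F L≡Fpq refl refl F11≡R = trans L≡Fpq F11≡R

at-unit₃ : ∀ {L R : ℚ} (F : ℚ → ℚ → ℚ → ℚ) {p q r} →
  L ≡ F p q r → p ≡ 1ℚ → q ≡ 1ℚ → r ≡ 1ℚ → F 1ℚ 1ℚ 1ℚ ≡ R → L ≡ R
at-unit₃ F L≡Fpqr refl refl refl F111≡R = trans L≡Fpqr F111≡R

u-[x-1] : ∀ u x → u - (x - 1ℚ) ≡ u - x + 1ℚ
u-[x-1] = solve-∀ ringℚ

u-[x-1]-1 : ∀ u x → u - (x - 1ℚ) - 1ℚ ≡ u - x
u-[x-1]-1 = solve-∀ ringℚ

zero-factor : ∀ s {f} g k → f ≡ 0ℚ → s * (f * g) * k ≡ 0ℚ
zero-factor s g k refl = vanish s g k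
  where
  vanish : ∀ s g k → s * (0ℚ * g) * k ≡ 0ℚ
  vanish = solve-∀ ringℚ

-- The hypergeometric kernel
--
-- The states of F enter at x = n (n ∉ A) and x = n - 1 (n ∈ A); with u = N - 1 + t, Φ (N - 1) m is the
-- factor (-1)^(m-1) binom(t, m) (1-N)_m / (1-N-t)_m of G.

module Kernel (u : ℚ) where

  κ : ℕ → ℚ
  κ m = inv (factorial m) * inv (falling u m)

  Φ : ℚ → ℕ → ℚ
  Φ x zero = 0ℚ
  Φ x (suc j) = sign j * (falling x (suc j) * falling (u - x) (suc j)) * κ (suc j)

  Φ₀ : ℚ → ℕ → ℚ
  Φ₀ x zero = 0ℚ
  Φ₀ x (suc j) = sign j * (falling x (suc j) * falling (u - x) j) * κ (suc j)

  Φ₁ : ℚ → ℕ → ℚ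
  Φ₁ x zero = 0ℚ
  Φ₁ x (suc j) = sign j * (falling x j * falling (u - x) (suc j)) * κ (suc j)

  Ψ₀ : ℚ → ℕ → ℚ
  Ψ₀ x zero = 0ℚ
  Ψ₀ x (suc j) = x * (u - ℕ→ℚ j) * Φ₀ x (suc j)

  Ψ₁ : ℚ → ℕ → ℚ
  Ψ₁ x zero = 0ℚ
  Ψ₁ x (suc j) = (u - x) * (u - ℕ→ℚ j) * Φ₁ x (suc j)

  falling-u-[x-1] : ∀ x j → falling (u - (x - 1ℚ)) (suc j) ≡ (u - x + 1ℚ) * falling (u - x) j
  falling-u-[x-1] x j = cong₂ _*_ (u-[x-1] u x) (cong (λ z → falling z j) (u-[x-1]-1 u x))

  Φ-unfold : ∀ x j → Φ x (suc j) ≡ sign j * ((x * falling (x - 1ℚ) j) * (falling (u - x) j * (u - x - ℕ→ℚ j))) * κ (suc j)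
  Φ-unfold x j = cong (λ z → sign j * ((x * falling (x - 1ℚ) j) * z) * κ (suc j)) (falling-snoc (u - x) j)

  Φ-[x-1]-unfold : ∀ x j → Φ (x - 1ℚ) (suc j) ≡ sign j * ((falling (x - 1ℚ) j * (x - 1ℚ - ℕ→ℚ j)) * ((u - x + 1ℚ) * falling (u - x) j)) * κ (suc j)
  Φ-[x-1]-unfold x j = cong₂ (λ y z → sign j * (y * z) * κ (suc j)) (falling-snoc (x - 1ℚ) j) (falling-u-[x-1] x j)

  Φ-difference : ∀ x j a b → a * x ≡ 1ℚ → b * (u - x + 1ℚ) ≡ 1ℚ →
    ℕ→ℚ (suc j) * (a * Φ x (suc j) - b * Φ (x - 1ℚ) (suc j)) ≡ Φ x (suc j) - Φ (x - 1ℚ) (suc j)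
  Φ-difference x j a b ax bx = begin
    ℕ→ℚ (suc j) * (a * Φ x (suc j) - b * Φ (x - 1ℚ) (suc j))
      ≡⟨ cong₂ (λ m z → m * (a * z - b * Φ (x - 1ℚ) (suc j))) (ℕ→ℚ-suc j) (Φ-unfold x j) ⟩
    (1ℚ + jq) * (a * (s * ((x * A) * (B * (u - x - jq))) * K) - b * Φ (x - 1ℚ) (suc j))
      ≡⟨ cong (λ z → (1ℚ + jq) * (a * (s * ((x * A) * (B * (u - x - jq))) * K) - b * z)) (Φ-[x-1]-unfold x j) ⟩
    (1ℚ + jq) * (a * (s * ((x * A) * (B * (u - x - jq))) * K) - b * (s * ((A * (x - 1ℚ - jq)) * ((u - x + 1ℚ) * B)) * K))
      ≡⟨ at-unit₂ (λ p q → (1ℚ + jq) * (p * (s * A * B * (u - x - jq) * K) - q * (s * A * (x - 1ℚ - jq) * B * K)))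
           (ring₁ u x a b s A B K jq) ax bx (ring₂ u x s A B K jq) ⟩
    s * ((x * A) * (B * (u - x - jq))) * K - s * ((A * (x - 1ℚ - jq)) * ((u - x + 1ℚ) * B)) * K
      ≡⟨ sym (cong₂ _-_ (Φ-unfold x j) (Φ-[x-1]-unfold x j)) ⟩
    Φ x (suc j) - Φ (x - 1ℚ) (suc j) ∎
    where
    open ≡-Reasoning
    s = sign j
    A = falling (x - 1ℚ) j
    B = falling (u - x) j
    K = κ (suc j)
    jq = ℕ→ℚ j
    ring₁ : ∀ u x a b s A B K jq →
      (1ℚ + jq) * (a * (s * ((x * A) * (B * (u - x - jq))) * K) - b * (s * ((A * (x - 1ℚ - jq)) * ((u - x + 1ℚ) * B)) * K))
      ≡ (1ℚ + jq) * ((a * x) * (s * A * B * (u - x - jq) * K) - (b * (u - x + 1ℚ)) * (s * A * (x - 1ℚ - jq) * B * K))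
    ring₁ = solve-∀ ringℚ
    ring₂ : ∀ u x s A B K jq →
      (1ℚ + jq) * (1ℚ * (s * A * B * (u - x - jq) * K) - 1ℚ * (s * A * (x - 1ℚ - jq) * B * K))
      ≡ s * ((x * A) * (B * (u - x - jq))) * K - s * ((A * (x - 1ℚ - jq)) * ((u - x + 1ℚ) * B)) * K
    ring₂ = solve-∀ ringℚ

  Φ₀-unfold₂ : ∀ x j → Φ₀ x (suc (suc j)) ≡ sign (suc j) * ((x * (falling (x - 1ℚ) j * (x - 1ℚ - ℕ→ℚ j))) * (falling (u - x) j * (u - x - ℕ→ℚ j))) * κ (suc (suc j))
  Φ₀-unfold₂ x j = cong₂ (λ y z → sign (suc j) * ((x * y) * z) * κ (suc (suc j))) (falling-snoc (x - 1ℚ) j) (falling-snoc (u - x) j)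

  Φ₁-unfold₂ : ∀ x j → Φ₁ x (suc (suc j)) ≡ sign (suc j) * ((x * falling (x - 1ℚ) j) * ((falling (u - x) j * (u - x - ℕ→ℚ j)) * (u - x - ℕ→ℚ (suc j)))) * κ (suc (suc j))
  Φ₁-unfold₂ x j = cong (λ z → sign (suc j) * ((x * falling (x - 1ℚ) j) * z) * κ (suc (suc j)))
    (trans (falling-snoc (u - x) (suc j)) (cong (_* (u - x - ℕ→ℚ (suc j))) (falling-snoc (u - x) j)))

  Φ-unfoldˡ : ∀ x j → Φ x (suc j) ≡ sign j * ((falling x j * (x - ℕ→ℚ j)) * falling (u - x) (suc j)) * κ (suc j)
  Φ-unfoldˡ x j = cong (λ z → sign j * (z * falling (u - x) (suc j)) * κ (suc j)) (falling-snoc x j)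

  κ-step : ∀ j → falling u (suc (suc j)) ≢ 0ℚ → κ (suc j) ≡ κ (suc (suc j)) * (ℕ→ℚ (suc (suc j)) * (u - ℕ→ℚ (suc j)))
  κ-step j u↓≢0 = sym (begin
    inv (f * m) * inv (falling u (suc (suc j))) * (m * d)
      ≡⟨ cong (λ z → inv (f * m) * inv z * (m * d)) (falling-snoc u (suc j)) ⟩
    inv (f * m) * inv (g * d) * (m * d)
      ≡⟨ cong₂ (λ y z → y * z * (m * d)) (inv-distrib-* f m f≢0 m≢0) (inv-distrib-* g d g≢0 d≢0) ⟩
    (inv f * inv m) * (inv g * inv d) * (m * d)
      ≡⟨ regroup (inv f) (inv m) (inv g) (inv d) m d ⟩
    (inv f * inv g) * ((inv m * m) * (inv d * d))
      ≡⟨ cong₂ (λ y z → (inv f * inv g) * (y * z)) (inv-inverseˡ m m≢0) (inv-inverseˡ d d≢0) ⟩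
    (inv f * inv g) * 1ℚ
      ≡⟨ *-identityʳ (inv f * inv g) ⟩
    κ (suc j) ∎)
    where
    open ≡-Reasoning
    f = factorial (suc j)
    g = falling u (suc j)
    m = ℕ→ℚ (suc (suc j))
    d = u - ℕ→ℚ (suc j)
    f≢0 = factorial≢0 (suc j)
    m≢0 = ℕ→ℚ-suc≢0 (suc j)
    gd≢0 : g * d ≢ 0ℚ
    gd≢0 gd≡0 = u↓≢0 (trans (falling-snoc u (suc j)) gd≡0)
    g≢0 = *≢0⇒≢0ˡ g d gd≢0
    d≢0 = *≢0⇒≢0ʳ g d gd≢0
    regroup : ∀ a b c e m d → ((a * b) * (c * e)) * (m * d) ≡ (a * c) * ((b * m) * (e * d))
    regroup = solve-∀ ringℚ

  Φ-unfold-κ₂ : ∀ x j → falling u (suc (suc j)) ≢ 0ℚ →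
    Φ x (suc j) ≡ sign j * ((x * falling (x - 1ℚ) j) * (falling (u - x) j * (u - x - ℕ→ℚ j)))
                    * (κ (suc (suc j)) * (ℕ→ℚ (suc (suc j)) * (u - ℕ→ℚ (suc j))))
  Φ-unfold-κ₂ x j u↓≢0 =
    trans (Φ-unfold x j) (cong (sign j * ((x * falling (x - 1ℚ) j) * (falling (u - x) j * (u - x - ℕ→ℚ j))) *_) (κ-step j u↓≢0))

  Φ-Ψ₀-step : ∀ x j w → w * x ≡ 1ℚ → falling u (suc (suc j)) ≢ 0ℚ →
    Φ x (suc j) * (ℕ→ℚ (suc j) * w - 1ℚ) ≡ ℕ→ℚ (suc (suc j)) * (w * w) * Ψ₀ x (suc (suc j))
  Φ-Ψ₀-step x j w wx u↓≢0 = begin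
    Φ x (suc j) * (m1 * w - 1ℚ)
      ≡⟨ cong (λ z → z * (m1 * w - 1ℚ)) (Φ-unfold-κ₂ x j u↓≢0) ⟩
    s * ((x * A) * (B * (u - x - jq))) * (K2 * (m2 * (u - m1))) * (m1 * w - 1ℚ)
      ≡⟨ at-unit₁ (λ p → s * A * B * (u - x - jq) * K2 * m2 * (u - m1) * (m1 * p - x)) (ring₁ u x w s A B K2 jq m1 m2) wx refl ⟩
    s * A * B * (u - x - jq) * K2 * m2 * (u - m1) * (m1 * 1ℚ - x)
      ≡⟨ cong (λ z → s * A * B * (u - x - jq) * K2 * m2 * (u - m1) * (z * 1ℚ - x)) (ℕ→ℚ-suc j) ⟩
    s * A * B * (u - x - jq) * K2 * m2 * (u - m1) * ((1ℚ + jq) * 1ℚ - x)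
      ≡⟨ ring₂ u x s A B K2 jq m1 m2 ⟩
    m2 * (u - m1) * (- s) * A * (x - 1ℚ - jq) * B * (u - x - jq) * K2 * 1ℚ * 1ℚ
      ≡⟨ sym (at-unit₁ (λ p → m2 * (u - m1) * (- s) * A * (x - 1ℚ - jq) * B * (u - x - jq) * K2 * p * p) (ring₃ u x w s A B K2 jq m1 m2) wx refl) ⟩
    m2 * (w * w) * (x * (u - m1) * (- s * ((x * (A * (x - 1ℚ - jq))) * (B * (u - x - jq))) * K2))
      ≡⟨ sym (cong (λ z → m2 * (w * w) * (x * (u - m1) * z)) (Φ₀-unfold₂ x j)) ⟩
    m2 * (w * w) * Ψ₀ x (suc (suc j)) ∎
    where
    open ≡-Reasoning
    s = sign j
    A = falling (x - 1ℚ) j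
    B = falling (u - x) j
    K2 = κ (suc (suc j))
    jq = ℕ→ℚ j
    m1 = ℕ→ℚ (suc j)
    m2 = ℕ→ℚ (suc (suc j))
    ring₁ : ∀ u x w s A B K2 jq m1 m2 →
      s * ((x * A) * (B * (u - x - jq))) * (K2 * (m2 * (u - m1))) * (m1 * w - 1ℚ)
      ≡ s * A * B * (u - x - jq) * K2 * m2 * (u - m1) * (m1 * (w * x) - x)
    ring₁ = solve-∀ ringℚ
    ring₂ : ∀ u x s A B K2 jq m1 m2 →
      s * A * B * (u - x - jq) * K2 * m2 * (u - m1) * ((1ℚ + jq) * 1ℚ - x)
      ≡ m2 * (u - m1) * (- s) * A * (x - 1ℚ - jq) * B * (u - x - jq) * K2 * 1ℚ * 1ℚ
    ring₂ = solve-∀ ringℚ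
    ring₃ : ∀ u x w s A B K2 jq m1 m2 →
      m2 * (w * w) * (x * (u - m1) * (- s * ((x * (A * (x - 1ℚ - jq))) * (B * (u - x - jq))) * K2))
      ≡ m2 * (u - m1) * (- s) * A * (x - 1ℚ - jq) * B * (u - x - jq) * K2 * (w * x) * (w * x)
    ring₃ = solve-∀ ringℚ

  Φ-Ψ₁-step : ∀ x j w → w * (u - x) ≡ 1ℚ → falling u (suc (suc j)) ≢ 0ℚ →
    Φ x (suc j) * (ℕ→ℚ (suc j) * w - 1ℚ) ≡ ℕ→ℚ (suc (suc j)) * (w * w) * Ψ₁ x (suc (suc j))
  Φ-Ψ₁-step x j w wx u↓≢0 = *-cancelˡ-≢0 (u - x) _ _ (inverse⇒≢0 w (u - x) wx) (begin
    (u - x) * (Φ x (suc j) * (m1 * w - 1ℚ))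
      ≡⟨ cong (λ z → (u - x) * (z * (m1 * w - 1ℚ))) (Φ-unfold-κ₂ x j u↓≢0) ⟩
    (u - x) * (s * ((x * A) * (B * (u - x - jq))) * (K2 * (m2 * (u - m1))) * (m1 * w - 1ℚ))
      ≡⟨ at-unit₁ (λ p → s * x * A * B * (u - x - jq) * K2 * m2 * (u - m1) * (m1 * p - (u - x))) (ring₁ u x w s A B K2 jq m1 m2) wx refl ⟩
    s * x * A * B * (u - x - jq) * K2 * m2 * (u - m1) * (m1 * 1ℚ - (u - x))
      ≡⟨ subst (λ m1 → s * x * A * B * (u - x - jq) * K2 * m2 * (u - m1) * (m1 * 1ℚ - (u - x))
                     ≡ m2 * (u - m1) * (- s) * x * A * B * (u - x - jq) * (u - x - m1) * K2 * 1ℚ * 1ℚ)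
               (sym (ℕ→ℚ-suc j)) (ring₂ u x s A B K2 jq m2) ⟩
    m2 * (u - m1) * (- s) * x * A * B * (u - x - jq) * (u - x - m1) * K2 * 1ℚ * 1ℚ
      ≡⟨ sym (at-unit₁ (λ p → m2 * (u - m1) * (- s) * x * A * B * (u - x - jq) * (u - x - m1) * K2 * p * p) (ring₃ u x w s A B K2 jq m1 m2) wx refl) ⟩
    (u - x) * (m2 * (w * w) * ((u - x) * (u - m1) * (- s * ((x * A) * ((B * (u - x - jq)) * (u - x - m1))) * K2)))
      ≡⟨ sym (cong (λ z → (u - x) * (m2 * (w * w) * ((u - x) * (u - m1) * z))) (Φ₁-unfold₂ x j)) ⟩
    (u - x) * (m2 * (w * w) * Ψ₁ x (suc (suc j))) ∎)
    where
    open ≡-Reasoning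
    s = sign j
    A = falling (x - 1ℚ) j
    B = falling (u - x) j
    K2 = κ (suc (suc j))
    jq = ℕ→ℚ j
    m1 = ℕ→ℚ (suc j)
    m2 = ℕ→ℚ (suc (suc j))
    ring₁ : ∀ u x w s A B K2 jq m1 m2 →
      (u - x) * (s * ((x * A) * (B * (u - x - jq))) * (K2 * (m2 * (u - m1))) * (m1 * w - 1ℚ))
      ≡ s * x * A * B * (u - x - jq) * K2 * m2 * (u - m1) * (m1 * (w * (u - x)) - (u - x))
    ring₁ = solve-∀ ringℚ
    ring₂ : ∀ u x s A B K2 jq m2 →
      s * x * A * B * (u - x - jq) * K2 * m2 * (u - (1ℚ + jq)) * ((1ℚ + jq) * 1ℚ - (u - x))
      ≡ m2 * (u - (1ℚ + jq)) * (- s) * x * A * B * (u - x - jq) * (u - x - (1ℚ + jq)) * K2 * 1ℚ * 1ℚ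
    ring₂ = solve-∀ ringℚ
    ring₃ : ∀ u x w s A B K2 jq m1 m2 →
      (u - x) * (m2 * (w * w) * ((u - x) * (u - m1) * (- s * ((x * A) * ((B * (u - x - jq)) * (u - x - m1))) * K2)))
      ≡ m2 * (u - m1) * (- s) * x * A * B * (u - x - jq) * (u - x - m1) * K2 * (w * (u - x)) * (w * (u - x))
    ring₃ = solve-∀ ringℚ

  Ψ₀-difference : ∀ x j w v → w * x ≡ 1ℚ → v * (u - ℕ→ℚ j) ≡ 1ℚ → Ψ₀ x (suc j) * (w - v) ≡ Φ x (suc j)
  Ψ₀-difference x j w v wx vx = begin
    Ψ₀ x (suc j) * (w - v)
      ≡⟨ at-unit₂ (λ p q → s * x * A * B * K * ((u - jq) * p - x * q)) (ring₁ u x w v s A B K jq) wx vx (ring₂ u x s A B K jq) ⟩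
    s * ((x * A) * (B * (u - x - jq))) * K
      ≡⟨ sym (Φ-unfold x j) ⟩
    Φ x (suc j) ∎
    where
    open ≡-Reasoning
    s = sign j
    A = falling (x - 1ℚ) j
    B = falling (u - x) j
    K = κ (suc j)
    jq = ℕ→ℚ j
    ring₁ : ∀ u x w v s A B K jq → x * (u - jq) * (s * ((x * A) * B) * K) * (w - v)
       ≡ s * x * A * B * K * ((u - jq) * (w * x) - x * (v * (u - jq)))
    ring₁ = solve-∀ ringℚ
    ring₂ : ∀ u x s A B K jq → s * x * A * B * K * ((u - jq) * 1ℚ - x * 1ℚ) ≡ s * ((x * A) * (B * (u - x - jq))) * K
    ring₂ = solve-∀ ringℚ

  Ψ₁-difference : ∀ x j w v → w * (u - x) ≡ 1ℚ → v * (u - ℕ→ℚ j) ≡ 1ℚ → Ψ₁ x (suc j) * (w - v) ≡ Φ x (suc j)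
  Ψ₁-difference x j w v wx vx = begin
    Ψ₁ x (suc j) * (w - v)
      ≡⟨ at-unit₂ (λ p q → s * C * D * K * ((u - jq) * p - (u - x) * q)) (ring₁ u x w v s C D K jq) wx vx (ring₂ u x s C D K jq) ⟩
    s * ((C * (x - jq)) * D) * K
      ≡⟨ sym (Φ-unfoldˡ x j) ⟩
    Φ x (suc j) ∎
    where
    open ≡-Reasoning
    s = sign j
    C = falling x j
    D = falling (u - x) (suc j)
    K = κ (suc j)
    jq = ℕ→ℚ j
    ring₁ : ∀ u x w v s C D K jq → (u - x) * (u - jq) * (s * (C * D) * K) * (w - v)
       ≡ s * C * D * K * ((u - jq) * (w * (u - x)) - (u - x) * (v * (u - jq)))
    ring₁ = solve-∀ ringℚ
    ring₂ : ∀ u x s C D K jq → s * C * D * K * ((u - jq) * 1ℚ - (u - x) * 1ℚ) ≡ s * ((C * (x - jq)) * D) * K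
    ring₂ = solve-∀ ringℚ

  Ψ-cross : ∀ x j a b → a * x ≡ 1ℚ → b * (u - x + 1ℚ) ≡ 1ℚ →
    a * a * a * Ψ₀ x (suc j) - b * b * b * Ψ₁ (x - 1ℚ) (suc j) ≡ a * a * Φ x (suc j) - b * b * Φ (x - 1ℚ) (suc j)
  Ψ-cross x j a b ax bx = begin
    a * a * a * Ψ₀ x (suc j) - b * b * b * Ψ₁ (x - 1ℚ) (suc j)
      ≡⟨ cong₂ (λ y z → a * a * a * Ψ₀ x (suc j) - b * b * b * (y * (u - jq) * (s * (A * z) * K))) (u-[x-1] u x) (falling-u-[x-1] x j) ⟩
    a * a * a * (x * (u - jq) * (s * ((x * A) * B) * K)) - b * b * b * ((u - x + 1ℚ) * (u - jq) * (s * (A * ((u - x + 1ℚ) * B)) * K))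
      ≡⟨ at-unit₂ Ψ-side (ring₁ u x a b s A B K jq) ax bx (ring₂ u x a b s A B K jq) ⟩
    Φ-side 1ℚ 1ℚ + s * A * B * K * (a * x - b * (u - x + 1ℚ))
      ≡⟨ cong₂ (λ p q → Φ-side 1ℚ 1ℚ + s * A * B * K * (p - q)) ax bx ⟩
    Φ-side 1ℚ 1ℚ + s * A * B * K * (1ℚ - 1ℚ)
      ≡⟨ ring₃ (Φ-side 1ℚ 1ℚ) (s * A * B * K) ⟩
    Φ-side 1ℚ 1ℚ
      ≡⟨ sym (cong₂ Φ-side ax bx) ⟩
    Φ-side (a * x) (b * (u - x + 1ℚ))
      ≡⟨ sym (ring₄ u x a b s A B K jq) ⟩
    a * a * (s * ((x * A) * (B * (u - x - jq))) * K) - b * b * (s * ((A * (x - 1ℚ - jq)) * ((u - x + 1ℚ) * B)) * K)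
      ≡⟨ sym (cong₂ (λ y z → a * a * y - b * b * z) (Φ-unfold x j) (Φ-[x-1]-unfold x j)) ⟩
    a * a * Φ x (suc j) - b * b * Φ (x - 1ℚ) (suc j) ∎
    where
    open ≡-Reasoning
    s = sign j
    A = falling (x - 1ℚ) j
    B = falling (u - x) j
    K = κ (suc j)
    jq = ℕ→ℚ j
    Ψ-side : ℚ → ℚ → ℚ
    Ψ-side p q = a * p * p * (u - jq) * s * A * B * K - b * q * q * (u - jq) * s * A * B * K
    Φ-side : ℚ → ℚ → ℚ
    Φ-side p q = a * p * s * A * B * (u - x - jq) * K - b * q * s * A * (x - 1ℚ - jq) * B * K
    ring₁ : ∀ u x a b s A B K jq →
      a * a * a * (x * (u - jq) * (s * ((x * A) * B) * K)) - b * b * b * ((u - x + 1ℚ) * (u - jq) * (s * (A * ((u - x + 1ℚ) * B)) * K))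
      ≡ a * (a * x) * (a * x) * (u - jq) * s * A * B * K - b * (b * (u - x + 1ℚ)) * (b * (u - x + 1ℚ)) * (u - jq) * s * A * B * K
    ring₁ = solve-∀ ringℚ
    ring₂ : ∀ u x a b s A B K jq →
      a * 1ℚ * 1ℚ * (u - jq) * s * A * B * K - b * 1ℚ * 1ℚ * (u - jq) * s * A * B * K
      ≡ (a * 1ℚ * s * A * B * (u - x - jq) * K - b * 1ℚ * s * A * (x - 1ℚ - jq) * B * K) + s * A * B * K * (a * x - b * (u - x + 1ℚ))
    ring₂ = solve-∀ ringℚ
    ring₃ : ∀ g c → g + c * (1ℚ - 1ℚ) ≡ g
    ring₃ = solve-∀ ringℚ
    ring₄ : ∀ u x a b s A B K jq →
      a * a * (s * ((x * A) * (B * (u - x - jq))) * K) - b * b * (s * ((A * (x - 1ℚ - jq)) * ((u - x + 1ℚ) * B)) * K)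
      ≡ a * (a * x) * s * A * B * (u - x - jq) * K - b * (b * (u - x + 1ℚ)) * s * A * (x - 1ℚ - jq) * B * K
    ring₄ = solve-∀ ringℚ

  u*κ₁ : u ≢ 0ℚ → u * κ 1 ≡ 1ℚ
  u*κ₁ u≢0 = begin
    u * (1ℚ * inv (u * 1ℚ))  ≡⟨ cong (λ z → u * (1ℚ * inv z)) (*-identityʳ u) ⟩
    u * (1ℚ * inv u)         ≡⟨ cong (u *_) (*-identityˡ (inv u)) ⟩
    u * inv u                ≡⟨ inv-inverseʳ u u≢0 ⟩
    1ℚ                       ∎
    where open ≡-Reasoning

  Φ-primitive-1 : ∀ x a b → a * x ≡ 1ℚ → b * (u - x + 1ℚ) ≡ 1ℚ → u ≢ 0ℚ →
    a * a * Φ x 1 - b * b * Φ (x - 1ℚ) 1 ≡ a - b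
  Φ-primitive-1 x a b ax bx u≢0 = begin
    a * a * Φ x 1 - b * b * Φ (x - 1ℚ) 1
      ≡⟨ cong (λ z → a * a * Φ x 1 - b * b * (1ℚ * (((x - 1ℚ) * 1ℚ) * (z * 1ℚ)) * k₁)) (u-[x-1] u x) ⟩
    a * a * (1ℚ * ((x * 1ℚ) * ((u - x) * 1ℚ)) * k₁) - b * b * (1ℚ * (((x - 1ℚ) * 1ℚ) * ((u - x + 1ℚ) * 1ℚ)) * k₁)
      ≡⟨ at-unit₃ (λ p q r → p * (a * r - p * k₁) - q * (b * r - q * k₁)) (expand u x a b k₁) ax bx (u*κ₁ u≢0) (collapse a b k₁) ⟩
    a - b ∎
    where
    open ≡-Reasoning
    k₁ = κ 1
    expand : ∀ u x a b k →
      a * a * (1ℚ * ((x * 1ℚ) * ((u - x) * 1ℚ)) * k) - b * b * (1ℚ * (((x - 1ℚ) * 1ℚ) * ((u - x + 1ℚ) * 1ℚ)) * k)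
      ≡ (a * x) * (a * (u * k) - (a * x) * k) - (b * (u - x + 1ℚ)) * (b * (u * k) - (b * (u - x + 1ℚ)) * k)
    expand = solve-∀ ringℚ
    collapse : ∀ a b k → 1ℚ * (a * 1ℚ - 1ℚ * k) - 1ℚ * (b * 1ℚ - 1ℚ * k) ≡ a - b
    collapse = solve-∀ ringℚ

  Ψ₀-1 : ∀ x w → w * x ≡ 1ℚ → u ≢ 0ℚ → w * w * Ψ₀ x 1 ≡ 1ℚ
  Ψ₀-1 x w wx u≢0 = at-unit₂ (λ p r → p * p * r) (expand u x w (κ 1)) wx (u*κ₁ u≢0) refl
    where
    expand : ∀ u x w k → w * w * (x * (u - 0ℚ) * (1ℚ * ((x * 1ℚ) * 1ℚ) * k)) ≡ (w * x) * (w * x) * (u * k)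
    expand = solve-∀ ringℚ

  Ψ₁-1 : ∀ x w → w * (u - x) ≡ 1ℚ → u ≢ 0ℚ → w * w * Ψ₁ x 1 ≡ 1ℚ
  Ψ₁-1 x w wx u≢0 = at-unit₂ (λ p r → p * p * r) (expand u x w (κ 1)) wx (u*κ₁ u≢0) refl
    where
    expand : ∀ u x w k → w * w * ((u - x) * (u - 0ℚ) * (1ℚ * (1ℚ * ((u - x) * 1ℚ)) * k)) ≡ (w * (u - x)) * (w * (u - x)) * (u * k)
    expand = solve-∀ ringℚ

  Φ-vanish : ∀ K m → K < m → Φ (ℕ→ℚ K) m ≡ 0ℚ
  Φ-vanish K (suc j) K<m = zero-factor (sign j) (falling (u - ℕ→ℚ K) (suc j)) (κ (suc j)) (falling-vanish K (suc j) K<m)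

  Φ₀-vanish : ∀ K m → K < m → Φ₀ (ℕ→ℚ K) m ≡ 0ℚ
  Φ₀-vanish K (suc j) K<m = zero-factor (sign j) (falling (u - ℕ→ℚ K) j) (κ (suc j)) (falling-vanish K (suc j) K<m)

  Φ₁-vanish : ∀ K j → K < j → Φ₁ (ℕ→ℚ K) (suc j) ≡ 0ℚ
  Φ₁-vanish K j K<j = zero-factor (sign j) (falling (u - ℕ→ℚ K) (suc j)) (κ (suc j)) (falling-vanish K j K<j)

  Φ-primitive : ℚ → ℚ → ℚ → ℕ → ℚ
  Φ-primitive x a b k = ℕ→ℚ k * (a * a * Φ x k - b * b * Φ (x - 1ℚ) k)

  Φ-telescope : ∀ x j a b → a * x ≡ 1ℚ → b * (u - x + 1ℚ) ≡ 1ℚ → falling u (suc (suc j)) ≢ 0ℚ →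
    a * Φ x (suc j) - b * Φ (x - 1ℚ) (suc j) ≡ Φ-primitive x a b (suc j) - Φ-primitive x a b (suc (suc j))
  Φ-telescope x j a b ax by u↓≢0 = begin
    a * X - b * Y
      ≡⟨ split-primitive m₁ a b X Y ⟩
    P₁ - (a * (X * (m₁ * a - 1ℚ)) - b * (Y * (m₁ * b - 1ℚ)))
      ≡⟨ cong₂ (λ p q → P₁ - (a * p - b * q)) (Φ-Ψ₀-step x j a ax u↓≢0) (Φ-Ψ₁-step (x - 1ℚ) j b b[u-[x-1]]≡1 u↓≢0) ⟩
    P₁ - (a * (m₂ * (a * a) * Ψ₀ x (suc (suc j))) - b * (m₂ * (b * b) * Ψ₁ (x - 1ℚ) (suc (suc j))))
      ≡⟨ cong (λ z → P₁ - z) (collect m₂ a b (Ψ₀ x (suc (suc j))) (Ψ₁ (x - 1ℚ) (suc (suc j)))) ⟩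
    P₁ - m₂ * (a * a * a * Ψ₀ x (suc (suc j)) - b * b * b * Ψ₁ (x - 1ℚ) (suc (suc j)))
      ≡⟨ cong (λ z → P₁ - m₂ * z) (Ψ-cross x (suc j) a b ax by) ⟩
    P₁ - Φ-primitive x a b (suc (suc j)) ∎
    where
    open ≡-Reasoning
    X = Φ x (suc j)
    Y = Φ (x - 1ℚ) (suc j)
    m₁ = ℕ→ℚ (suc j)
    m₂ = ℕ→ℚ (suc (suc j))
    P₁ = Φ-primitive x a b (suc j)
    b[u-[x-1]]≡1 : b * (u - (x - 1ℚ)) ≡ 1ℚ
    b[u-[x-1]]≡1 = trans (cong (b *_) (u-[x-1] u x)) by
    split-primitive : ∀ m a b X Y → a * X - b * Y ≡ m * (a * a * X - b * b * Y) - (a * (X * (m * a - 1ℚ)) - b * (Y * (m * b - 1ℚ)))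
    split-primitive = solve-∀ ringℚ
    collect : ∀ m a b P Q → a * (m * (a * a) * P) - b * (m * (b * b) * Q) ≡ m * (a * a * a * P - b * b * b * Q)
    collect = solve-∀ ringℚ

-- Vectors indexed by states (τ, n), τ ∈ Bool, 1 ≤ n ≤ M

sg : Bool → ℚ
sg false = 1ℚ
sg true  = - 1ℚ

ind : Bool → ℚ
ind true  = 1ℚ
ind false = 0ℚ

ind-if : ∀ b x → ind b * x ≡ (if b then x else 0ℚ)
ind-if true  x = *-identityˡ x
ind-if false x = *-zeroˡ x

ind-+ : ∀ b x y c z w → ind b * x * y + ind c * z * w ≡ (if b then x * y else 0ℚ) + (if c then z * w else 0ℚ)
ind-+ b x y c z w = cong₂ _+_ (trans (*-assoc (ind b) x y) (ind-if b (x * y))) (trans (*-assoc (ind c) z w) (ind-if c (z * w)))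

module States (M : ℕ) where

  Vector : Set
  Vector = Bool → ℕ → ℚ

  sumStates : Vector → ℚ
  sumStates f = sumTo M (λ n → f false n + f true n)

  sumStates-cong : ∀ (f g : Vector) → (∀ τ n → 1 ≤ n → n ≤ M → f τ n ≡ g τ n) → sumStates f ≡ sumStates g
  sumStates-cong f g f≗g = sumTo-cong M _ _ (λ n 1≤n n≤M → cong₂ _+_ (f≗g false n 1≤n n≤M) (f≗g true n 1≤n n≤M))

  sumStates-zero : ∀ (f : Vector) → (∀ τ n → 1 ≤ n → n ≤ M → f τ n ≡ 0ℚ) → sumStates f ≡ 0ℚ
  sumStates-zero f f≗0 = sumTo-zero M _ (λ n 1≤n n≤M →
    trans (cong₂ _+_ (f≗0 false n 1≤n n≤M) (f≗0 true n 1≤n n≤M)) (+-identityʳ 0ℚ))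

  sumStates-* : ∀ c (f : Vector) → sumStates (λ τ n → c * f τ n) ≡ c * sumStates f
  sumStates-* c f = trans (sumTo-cong M _ _ (λ n _ _ → sym (*-distribˡ-+ c (f false n) (f true n)))) (sumTo-* M c _)

  sumStates-*ʳ : ∀ c (f : Vector) → sumStates (λ τ n → f τ n * c) ≡ sumStates f * c
  sumStates-*ʳ c f = begin
    sumStates (λ τ n → f τ n * c)  ≡⟨ sumStates-cong _ _ (λ τ n _ _ → *-comm (f τ n) c) ⟩
    sumStates (λ τ n → c * f τ n)  ≡⟨ sumStates-* c f ⟩
    c * sumStates f                ≡⟨ *-comm c (sumStates f) ⟩
    sumStates f * c                ∎
    where open ≡-Reasoning

  sumStates-swap : ∀ (f : Bool → ℕ → Vector) →
    sumStates (λ a i → sumStates (λ b j → f a i b j)) ≡ sumStates (λ b j → sumStates (λ a i → f a i b j))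
  sumStates-swap f = begin
    sumTo M (λ i → sumStates (f false i) + sumStates (f true i))
      ≡⟨ sumTo-cong M _ _ (λ i _ _ → sym (sumTo-+ M _ _)) ⟩
    sumTo M (λ i → sumTo M (λ j → (f false i false j + f false i true j) + (f true i false j + f true i true j)))
      ≡⟨ sumTo-cong M _ _ (λ i _ _ → sumTo-cong M _ _ (λ j _ _ →
           interchange (f false i false j) (f false i true j) (f true i false j) (f true i true j))) ⟩
    sumTo M (λ i → sumTo M (λ j → (f false i false j + f true i false j) + (f false i true j + f true i true j)))
      ≡⟨ sumTo-swap M M _ ⟩
    sumTo M (λ j → sumTo M (λ i → (f false i false j + f true i false j) + (f false i true j + f true i true j)))
      ≡⟨ sumTo-cong M _ _ (λ j _ _ → sumTo-+ M _ _) ⟩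
    sumTo M (λ j → sumStates (λ a i → f a i false j) + sumStates (λ a i → f a i true j)) ∎
    where
    open ≡-Reasoning
    interchange : ∀ a b c d → (a + b) + (c + d) ≡ (a + c) + (b + d)
    interchange = solve-∀ ringℚ

  sumStates-assoc : ∀ (c : Vector) (K : Bool → ℕ → Vector) (v : Vector) →
    sumStates (λ a i → c a i * sumStates (λ b j → K a i b j * v b j)) ≡ sumStates (λ b j → sumStates (λ a i → c a i * K a i b j) * v b j)
  sumStates-assoc c K v = begin
    sumStates (λ a i → c a i * sumStates (λ b j → K a i b j * v b j))
      ≡⟨ sumStates-cong _ _ (λ a i _ _ → sym (sumStates-* (c a i) (λ b j → K a i b j * v b j))) ⟩
    sumStates (λ a i → sumStates (λ b j → c a i * (K a i b j * v b j)))
      ≡⟨ sumStates-swap (λ a i b j → c a i * (K a i b j * v b j)) ⟩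
    sumStates (λ b j → sumStates (λ a i → c a i * (K a i b j * v b j)))
      ≡⟨ sumStates-cong _ _ (λ b j _ _ → trans
           (sumStates-cong _ _ (λ a i _ _ → sym (*-assoc (c a i) (K a i b j) (v b j))))
           (sumStates-*ʳ (v b j) (λ a i → c a i * K a i b j))) ⟩
    sumStates (λ b j → sumStates (λ a i → c a i * K a i b j) * v b j) ∎
    where open ≡-Reasoning

-- Transfer matrices of F and G, and the connector between them

module Transfer (M : ℕ) (t : ℚ) (t+m≢0 : ∀ m → 1 ≤ m → m < suc M → t + ℕ→ℚ m ≢ 0ℚ) where

  open States M public

  N : ℕ
  N = suc M

  u : ℚ
  u = ℕ→ℚ M + t

  open Kernel u public

  W₀ : ℕ → ℚ
  W₀ n = inv (ℕ→ℚ n)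

  W₁ : ℕ → ℚ
  W₁ n = inv (ℕ→ℚ (N ∸ n) + t)

  W : Bool → ℕ → ℚ
  W false n = W₀ n
  W true  n = W₁ n

  -- xₛ τ n = Kₛ τ n is where the kernel is evaluated at the state (τ, n); okF τ n' n holds iff n' ≤ Kₛ τ n.
  xₛ : Bool → ℕ → ℚ
  xₛ false n = ℕ→ℚ n
  xₛ true  n = ℕ→ℚ n - 1ℚ

  Kₛ : Bool → ℕ → ℕ
  Kₛ false n = n
  Kₛ true  n = pred n

  Kₛ≤M : ∀ τ n → n ≤ M → Kₛ τ n ≤ M
  Kₛ≤M false n n≤M = n≤M
  Kₛ≤M true  n n≤M = ℕₚ.≤-trans ℕₚ.pred[n]≤n n≤M

  xₛ≡Kₛ : ∀ τ n → 1 ≤ n → xₛ τ n ≡ ℕ→ℚ (Kₛ τ n)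
  xₛ≡Kₛ false n       _ = refl
  xₛ≡Kₛ true  (suc n) _ = ℕ→ℚ-suc-1 n

  pred< : ∀ n → 1 ≤ n → pred n < n
  pred< (suc n) _ = ℕₚ.≤-refl

  k+t≢0 : ∀ k → 1 ≤ k → k ≤ M → ℕ→ℚ k + t ≢ 0ℚ
  k+t≢0 k 1≤k k≤M k+t≡0 = t+m≢0 k 1≤k (s≤s k≤M) (trans (+-comm t (ℕ→ℚ k)) k+t≡0)

  u-j : ∀ j → j ≤ M → u - ℕ→ℚ j ≡ ℕ→ℚ (M ∸ j) + t
  u-j j j≤M = trans (swap (ℕ→ℚ M) t (ℕ→ℚ j)) (cong (_+ t) (sym (ℕ→ℚ-∸ M j j≤M)))
    where
    swap : ∀ a b c → a + b - c ≡ (a - c) + b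
    swap = solve-∀ ringℚ

  u-j≢0 : ∀ j → j < M → u - ℕ→ℚ j ≢ 0ℚ
  u-j≢0 j j<M e = k+t≢0 (M ∸ j) (ℕₚ.m<n⇒0<n∸m j<M) (ℕₚ.m∸n≤m M j) (trans (sym (u-j j (ℕₚ.<⇒≤ j<M))) e)

  u≢0 : 1 ≤ M → u ≢ 0ℚ
  u≢0 1≤M u≡0 = u-j≢0 0 1≤M (trans (+-identityʳ u) u≡0)

  falling-u≢0 : ∀ k → k ≤ M → falling u k ≢ 0ℚ
  falling-u≢0 zero    _   = 1≢0
  falling-u≢0 (suc k) k<M e =
    *-≢0 _ _ (falling-u≢0 k (ℕₚ.<⇒≤ k<M)) (u-j≢0 k k<M) (trans (sym (falling-snoc u k)) e)

  W₁-denominator : ∀ n → n ≤ N → ℕ→ℚ (N ∸ n) + t ≡ u - ℕ→ℚ n + 1ℚ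
  W₁-denominator n n≤N =
    trans (cong (_+ t) (ℕ→ℚ-∸ N n n≤N)) (trans (cong (λ z → z - ℕ→ℚ n + t) (ℕ→ℚ-suc M)) (shuffle (ℕ→ℚ M) (ℕ→ℚ n) t))
    where
    shuffle : ∀ a b c → 1ℚ + a - b + c ≡ a + c - b + 1ℚ
    shuffle = solve-∀ ringℚ

  W₀-inv : ∀ n → 1 ≤ n → W₀ n * ℕ→ℚ n ≡ 1ℚ
  W₀-inv (suc n) _ = inv-inverseˡ _ (ℕ→ℚ-suc≢0 n)

  W₁-inv : ∀ n → 1 ≤ n → n ≤ M → W₁ n * (u - ℕ→ℚ n + 1ℚ) ≡ 1ℚ
  W₁-inv n 1≤n n≤M = trans (cong (W₁ n *_) (sym (W₁-denominator n (ℕₚ.m≤n⇒m≤1+n n≤M))))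
    (inv-inverseˡ _ (k+t≢0 (N ∸ n) (ℕₚ.m<n⇒0<n∸m (s≤s n≤M)) (ℕₚ.∸-monoʳ-≤ N 1≤n)))

  W₁-inv′ : ∀ n → 1 ≤ n → n ≤ M → W₁ n * (u - (ℕ→ℚ n - 1ℚ)) ≡ 1ℚ
  W₁-inv′ n 1≤n n≤M = trans (cong (W₁ n *_) (u-[x-1] u (ℕ→ℚ n))) (W₁-inv n 1≤n n≤M)

  W₁-inv-pred : ∀ j → suc j ≤ M → W₁ (suc j) * (u - ℕ→ℚ j) ≡ 1ℚ
  W₁-inv-pred j j<M = trans (cong (λ z → W₁ (suc j) * (u - z)) (sym (ℕ→ℚ-suc-1 j))) (W₁-inv′ (suc j) (s≤s z≤n) j<M)

  -- A box word (true = "+", false = ",") is read from the right: "+" multiplies by the weight of the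
  -- current state, "," moves to the next state subject to the order conditions of S̄ (for F) or S* (for G).
  -- A state of G in A admits only a following ",", since k_i = 1 there; endG carries the last factor of G.
  okF : Bool → ℕ → ℕ → Bool
  okF τ' n n' = if τ' then n <ᵇ n' else n ≤ᵇ n'

  okG : Bool → Bool → ℕ → ℕ → Bool
  okG σ σ' m m' = if not σ ∧ σ' then m <ᵇ m' else m ≤ᵇ m'

  okG-false : ∀ σ m m' → okG σ false m m' ≡ (m ≤ᵇ m')
  okG-false true  m m' = refl
  okG-false false m m' = refl

  stepF : Bool → Vector → Vector
  stepF true v τ n = W τ n * v τ n
  stepF false v τ n = sumStates (λ τ' n' → (ind (okF τ' n n') * (sg τ' * W τ' n')) * v τ' n')

  stepG : Bool → Vector → Vector
  stepG true v true m = 0ℚ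
  stepG true v false m = W₀ m * v false m
  stepG false v σ m = sumStates (λ σ' m' → (ind (okG σ σ' m m') * W σ' m') * v σ' m')

  stepG-cong : ∀ b (v v' : Vector) → (∀ σ m → 1 ≤ m → m ≤ M → v σ m ≡ v' σ m) → ∀ σ m → 1 ≤ m → m ≤ M → stepG b v σ m ≡ stepG b v' σ m
  stepG-cong true v v' h true m 1≤m m≤M = refl
  stepG-cong true v v' h false m 1≤m m≤M = cong (W₀ m *_) (h false m 1≤m m≤M)
  stepG-cong false v v' h σ m 1≤m m≤M = sumStates-cong _ _ (λ σ' m' p' q' → cong ((ind (okG σ σ' m m') * W σ' m') *_) (h σ' m' p' q'))

  endF : Vector
  endF _ _ = 1ℚ

  endG : Vector
  endG true m = 0ℚ
  endG false m = Φ (ℕ→ℚ M) m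

  suffixF : List Bool → Vector
  suffixF [] = endF
  suffixF (b ∷ bs) = stepF b (suffixF bs)

  suffixG : List Bool → Vector
  suffixG [] = endG
  suffixG (b ∷ bs) = stepG b (suffixG bs)

  walkF : List Bool → ℚ
  walkF bs = sumStates (λ τ n → sg τ * W τ n * suffixF bs τ n)

  walkG : List Bool → ℚ
  walkG bs = sumStates (λ σ m → W σ m * suffixG bs σ m)

  Dcomma : Bool → ℕ → ℕ → ℚ
  Dcomma τ n m = sg τ * W τ n * Φ (xₛ τ n) m

  Dplus₀ : Bool → ℕ → ℕ → ℚ
  Dplus₀ τ n m = ℕ→ℚ m * W τ n * Dcomma τ n m

  Ψₛ : Bool → ℕ → ℕ → ℚ
  Ψₛ false n m = Ψ₀ (xₛ false n) m
  Ψₛ true n m = Ψ₁ (xₛ true n) m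

  Dplus₁ : Bool → ℕ → ℕ → ℚ
  Dplus₁ τ n m = ℕ→ℚ m * sg τ * (W τ n * W τ n * W τ n) * Ψₛ τ n m

  connector : Bool → Bool → ℕ → Bool → ℕ → ℚ
  connector false false m τ n = Dcomma τ n m
  connector false true m τ n = 0ℚ
  connector true false m τ n = Dplus₀ τ n m
  connector true true m τ n = Dplus₁ τ n m

  connect : Bool → Vector → Vector
  connect b v σ m = sumStates (λ τ n → connector b σ m τ n * v τ n)

  primitiveAt : ℕ → ℕ → ℚ
  primitiveAt n = Φ-primitive (ℕ→ℚ n) (W₀ n) (W₁ n)

  ΦW : ℕ → ℕ → ℚ
  ΦW K m = W₀ m * Φ (ℕ→ℚ K) m

  Ψₛ-top : ∀ τ n → 1 ≤ n → n ≤ M → Ψₛ τ n (suc M) ≡ 0ℚ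
  Ψₛ-top false n 1≤n n≤M = trans (cong (λ z → ℕ→ℚ n * (u - ℕ→ℚ M) * z) (Φ₀-vanish n (suc M) (s≤s n≤M))) (*-zeroʳ (ℕ→ℚ n * (u - ℕ→ℚ M)))
  Ψₛ-top true (suc n) 1≤n n≤M = trans (cong (λ z → (u - xₛ true (suc n)) * (u - ℕ→ℚ M) * Φ₁ z (suc M)) (xₛ≡Kₛ true (suc n) 1≤n))
    (trans (cong (λ z → (u - xₛ true (suc n)) * (u - ℕ→ℚ M) * z) (Φ₁-vanish n M n≤M)) (*-zeroʳ ((u - xₛ true (suc n)) * (u - ℕ→ℚ M))))

  Φ-Ψₛ-step-top : ∀ τ n → 1 ≤ n → n ≤ M →
    Φ (xₛ τ n) M * (ℕ→ℚ M * W τ n - 1ℚ) ≡ ℕ→ℚ (suc M) * (W τ n * W τ n) * Ψₛ τ n (suc M)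
  Φ-Ψₛ-step-top τ n 1≤n n≤M = trans (lhs≡0 τ) (sym (trans (cong (λ z → ℕ→ℚ (suc M) * (W τ n * W τ n) * z) (Ψₛ-top τ n 1≤n n≤M)) (*-zeroʳ (ℕ→ℚ (suc M) * (W τ n * W τ n)))))
    where
    ring₃ : ∀ a → a * (1ℚ - 1ℚ) ≡ 0ℚ
    ring₃ = solve-∀ ringℚ
    lhs≡0 : ∀ τ → Φ (xₛ τ n) M * (ℕ→ℚ M * W τ n - 1ℚ) ≡ 0ℚ
    lhs≡0 false with ℕₚ.m≤n⇒m<n∨m≡n n≤M
    ... | inj₁ n<M = trans (cong (_* (ℕ→ℚ M * W₀ n - 1ℚ)) (Φ-vanish n M n<M)) (*-zeroˡ (ℕ→ℚ M * W₀ n - 1ℚ))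
    ... | inj₂ eq = trans (cong (λ z → Φ (ℕ→ℚ n) M * (z - 1ℚ)) (trans (cong (λ k → ℕ→ℚ k * W₀ n) (sym eq)) (trans (*-comm (ℕ→ℚ n) (W₀ n)) (W₀-inv n 1≤n))))
                        (ring₃ (Φ (ℕ→ℚ n) M))
    lhs≡0 true = trans (cong (λ z → Φ z M * (ℕ→ℚ M * W₁ n - 1ℚ)) (xₛ≡Kₛ true n 1≤n))
       (trans (cong (_* (ℕ→ℚ M * W₁ n - 1ℚ)) (Φ-vanish (pred n) M (ℕₚ.<-≤-trans (pred< n 1≤n) n≤M))) (*-zeroˡ (ℕ→ℚ M * W₁ n - 1ℚ)))

  Φ-Ψₛ-step : ∀ τ n i → 1 ≤ n → n ≤ M → 1 ≤ i → i ≤ M →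
    Φ (xₛ τ n) i * (ℕ→ℚ i * W τ n - 1ℚ) ≡ ℕ→ℚ (suc i) * (W τ n * W τ n) * Ψₛ τ n (suc i)
  Φ-Ψₛ-step τ n (suc j) 1≤n n≤M _ i≤M with ℕₚ.m≤n⇒m<n∨m≡n i≤M
  Φ-Ψₛ-step false n (suc j) 1≤n n≤M _ i≤M | inj₁ i<M = Φ-Ψ₀-step (ℕ→ℚ n) j (W₀ n) (W₀-inv n 1≤n) (falling-u≢0 (suc (suc j)) i<M)
  Φ-Ψₛ-step true n (suc j) 1≤n n≤M _ i≤M | inj₁ i<M = Φ-Ψ₁-step (ℕ→ℚ n - 1ℚ) j (W₁ n) (W₁-inv′ n 1≤n n≤M) (falling-u≢0 (suc (suc j)) i<M)
  Φ-Ψₛ-step τ n (suc j) 1≤n n≤M _ i≤M | inj₂ eq =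
    subst (λ i → Φ (xₛ τ n) i * (ℕ→ℚ i * W τ n - 1ℚ) ≡ ℕ→ℚ (suc i) * (W τ n * W τ n) * Ψₛ τ n (suc i)) (sym eq) (Φ-Ψₛ-step-top τ n 1≤n n≤M)

  Ψₛ-difference : ∀ τ n i → 1 ≤ n → n ≤ M → 1 ≤ i → i ≤ M → Ψₛ τ n i * (W τ n - W₁ i) ≡ Φ (xₛ τ n) i
  Ψₛ-difference false n (suc j) 1≤n n≤M _ i≤M = Ψ₀-difference (ℕ→ℚ n) j (W₀ n) (W₁ (suc j)) (W₀-inv n 1≤n) (W₁-inv-pred j i≤M)
  Ψₛ-difference true n (suc j) 1≤n n≤M _ i≤M = Ψ₁-difference (ℕ→ℚ n - 1ℚ) j (W₁ n) (W₁ (suc j)) (W₁-inv′ n 1≤n n≤M) (W₁-inv-pred j i≤M)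

  Ψₛ-1 : ∀ τ n → 1 ≤ n → n ≤ M → W τ n * W τ n * Ψₛ τ n 1 ≡ 1ℚ
  Ψₛ-1 false n 1≤n n≤M = Ψ₀-1 (ℕ→ℚ n) (W₀ n) (W₀-inv n 1≤n) (u≢0 (ℕₚ.≤-trans 1≤n n≤M))
  Ψₛ-1 true n 1≤n n≤M = Ψ₁-1 (ℕ→ℚ n - 1ℚ) (W₁ n) (W₁-inv′ n 1≤n n≤M) (u≢0 (ℕₚ.≤-trans 1≤n n≤M))

  WDplus : Bool → ℕ → ℕ → ℚ
  WDplus τ n i = W₀ i * Dplus₀ τ n i + W₁ i * Dplus₁ τ n i

  Dplus-primitive : Bool → ℕ → ℕ → ℚ
  Dplus-primitive τ n i = Dplus₁ τ n i * W τ n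

  WDplus-telescope : ∀ τ n i → 1 ≤ n → n ≤ M → 1 ≤ i → i ≤ M → WDplus τ n i ≡ Dplus-primitive τ n i - Dplus-primitive τ n (suc i)
  WDplus-telescope τ n i 1≤n n≤M 1≤i i≤M = begin
    W₀ i * (iq * w * (s * w * Φi)) + v * (iq * s * (w * w * w) * Ψi)
      ≡⟨ at-unit₁ (λ r → r * (w * (s * w * Φi)) + v * (iq * s * (w * w * w) * Ψi)) (ring₁ (W₀ i) iq w s Φi v Ψi) (W₀-inv i 1≤i) refl ⟩
    1ℚ * (w * (s * w * Φi)) + v * (iq * s * (w * w * w) * Ψi)
      ≡⟨ cong (λ z → 1ℚ * (w * (s * w * z)) + v * (iq * s * (w * w * w) * Ψi)) (sym (Ψₛ-difference τ n i 1≤n n≤M 1≤i i≤M)) ⟩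
    1ℚ * (w * (s * w * (Ψi * (w - v)))) + v * (iq * s * (w * w * w) * Ψi)
      ≡⟨ ring₂ w s v iq Ψi ⟩
    iq * s * (w * w * w * w) * Ψi - s * w * w * ((Ψi * (w - v)) * (iq * w - 1ℚ))
      ≡⟨ cong (λ z → iq * s * (w * w * w * w) * Ψi - s * w * w * (z * (iq * w - 1ℚ))) (Ψₛ-difference τ n i 1≤n n≤M 1≤i i≤M) ⟩
    iq * s * (w * w * w * w) * Ψi - s * w * w * (Φi * (iq * w - 1ℚ))
      ≡⟨ cong (λ z → iq * s * (w * w * w * w) * Ψi - s * w * w * z) (Φ-Ψₛ-step τ n i 1≤n n≤M 1≤i i≤M) ⟩
    iq * s * (w * w * w * w) * Ψi - s * w * w * (i1 * (w * w) * Ψi')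
      ≡⟨ ring₃ iq s w Ψi i1 Ψi' ⟩
    (iq * s * (w * w * w) * Ψi) * w - (i1 * s * (w * w * w) * Ψi') * w ∎
    where
    open ≡-Reasoning
    w = W τ n
    s = sg τ
    v = W₁ i
    iq = ℕ→ℚ i
    i1 = ℕ→ℚ (suc i)
    Φi = Φ (xₛ τ n) i
    Ψi = Ψₛ τ n i
    Ψi' = Ψₛ τ n (suc i)
    ring₁ : ∀ a iq w s Φi v Ψi → a * (iq * w * (s * w * Φi)) + v * (iq * s * (w * w * w) * Ψi)
       ≡ (a * iq) * (w * (s * w * Φi)) + v * (iq * s * (w * w * w) * Ψi)
    ring₁ = solve-∀ ringℚ
    ring₂ : ∀ w s v iq Ψi → 1ℚ * (w * (s * w * (Ψi * (w - v)))) + v * (iq * s * (w * w * w) * Ψi)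
       ≡ iq * s * (w * w * w * w) * Ψi - s * w * w * ((Ψi * (w - v)) * (iq * w - 1ℚ))
    ring₂ = solve-∀ ringℚ
    ring₃ : ∀ iq s w Ψi i1 Ψi' → iq * s * (w * w * w * w) * Ψi - s * w * w * (i1 * (w * w) * Ψi')
       ≡ (iq * s * (w * w * w) * Ψi) * w - (i1 * s * (w * w * w) * Ψi') * w
    ring₃ = solve-∀ ringℚ

  Dplus-primitive-top : ∀ τ n → 1 ≤ n → n ≤ M → Dplus-primitive τ n (suc M) ≡ 0ℚ
  Dplus-primitive-top τ n 1≤n n≤M = trans (cong (λ z → ℕ→ℚ (suc M) * sg τ * (W τ n * W τ n * W τ n) * z * W τ n) (Ψₛ-top τ n 1≤n n≤M)) (ring (ℕ→ℚ (suc M)) (sg τ) (W τ n * W τ n * W τ n) (W τ n))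
    where ring : ∀ a b c w → a * b * c * 0ℚ * w ≡ 0ℚ
          ring = solve-∀ ringℚ

  sumFrom-WDplus : ∀ τ n m → 1 ≤ n → n ≤ M → 1 ≤ m → m ≤ suc M → sumFrom m M (WDplus τ n) ≡ Dplus-primitive τ n m
  sumFrom-WDplus τ n m 1≤n n≤M p' q' = trans (sumFrom-telescope m M (Dplus-primitive τ n) (WDplus τ n) p' q' (λ i mi iM → WDplus-telescope τ n i 1≤n n≤M (ℕₚ.≤-trans p' mi) iM))
    (trans (cong (λ z → Dplus-primitive τ n m - z) (Dplus-primitive-top τ n 1≤n n≤M)) (+-identityʳ (Dplus-primitive τ n m)))

  Φ-difference-W : ∀ n m → 1 ≤ n → n ≤ M → 1 ≤ m →
    W₀ m * Φ (ℕ→ℚ n) m - W₀ m * Φ (ℕ→ℚ n - 1ℚ) m ≡ W₀ n * Φ (ℕ→ℚ n) m - W₁ n * Φ (ℕ→ℚ n - 1ℚ) m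
  Φ-difference-W n (suc j) 1≤n n≤M _ = begin
    c * X - c * Y ≡⟨ ring₁ c X Y ⟩
    c * (X - Y) ≡⟨ cong (c *_) (sym (Φ-difference (ℕ→ℚ n) j (W₀ n) (W₁ n) (W₀-inv n 1≤n) (W₁-inv n 1≤n n≤M))) ⟩
    c * (ℕ→ℚ (suc j) * (W₀ n * X - W₁ n * Y)) ≡⟨ at-unit₁ (λ r → r * (W₀ n * X - W₁ n * Y)) (ring₂ c (ℕ→ℚ (suc j)) (W₀ n * X - W₁ n * Y)) (W₀-inv (suc j) (s≤s z≤n)) (*-identityˡ _) ⟩
    W₀ n * X - W₁ n * Y ∎
    where
    open ≡-Reasoning
    c = W₀ (suc j)
    X = Φ (ℕ→ℚ n) (suc j)
    Y = Φ (ℕ→ℚ n - 1ℚ) (suc j)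
    ring₁ : ∀ c X Y → c * X - c * Y ≡ c * (X - Y)
    ring₁ = solve-∀ ringℚ
    ring₂ : ∀ c m z → c * (m * z) ≡ (c * m) * z
    ring₂ = solve-∀ ringℚ

  sumTo-Dcomma : ∀ K m → K ≤ M → 1 ≤ m → m ≤ M → sumTo K (λ n → Dcomma false n m + Dcomma true n m) ≡ W₀ m * Φ (ℕ→ℚ K) m
  sumTo-Dcomma K m K≤M 1≤m m≤M = begin
    sumTo K (λ n → Dcomma false n m + Dcomma true n m)
      ≡⟨ sumTo-cong K _ (λ n → W₀ m * Φ (ℕ→ℚ n) m - W₀ m * Φ (ℕ→ℚ (pred n)) m) (λ n p' q' → column-difference n p' (ℕₚ.≤-trans q' K≤M)) ⟩
    sumTo K (λ n → W₀ m * Φ (ℕ→ℚ n) m - W₀ m * Φ (ℕ→ℚ (pred n)) m)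
      ≡⟨ sumTo-telescope K (λ k → W₀ m * Φ (ℕ→ℚ k) m) ⟩
    W₀ m * Φ (ℕ→ℚ K) m - W₀ m * Φ (ℕ→ℚ 0) m
      ≡⟨ cong (λ z → W₀ m * Φ (ℕ→ℚ K) m - W₀ m * z) (Φ-vanish 0 m 1≤m) ⟩
    W₀ m * Φ (ℕ→ℚ K) m - W₀ m * 0ℚ
      ≡⟨ ring (W₀ m * Φ (ℕ→ℚ K) m) (W₀ m) ⟩
    W₀ m * Φ (ℕ→ℚ K) m ∎
    where
    open ≡-Reasoning
    ring : ∀ a b → a - b * 0ℚ ≡ a
    ring = solve-∀ ringℚ
    ring₁ : ∀ a b X Y → 1ℚ * a * X + (- 1ℚ) * b * Y ≡ a * X - b * Y
    ring₁ = solve-∀ ringℚ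
    column-difference : ∀ n → 1 ≤ n → n ≤ M → Dcomma false n m + Dcomma true n m ≡ W₀ m * Φ (ℕ→ℚ n) m - W₀ m * Φ (ℕ→ℚ (pred n)) m
    column-difference n p' q' = trans (ring₁ (W₀ n) (W₁ n) (Φ (ℕ→ℚ n) m) (Φ (ℕ→ℚ n - 1ℚ) m))
      (trans (sym (Φ-difference-W n m p' q' 1≤m)) (cong (λ z → W₀ m * Φ (ℕ→ℚ n) m - W₀ m * Φ z m) (xₛ≡Kₛ true n p')))

  DplusRow : Bool → ℕ → ℕ → ℚ
  DplusRow false n m = Dplus₀ false n m + Dplus₀ true n m
  DplusRow true n m = Dplus₁ false n m + Dplus₁ true n m

  DplusRow-primitive : ∀ σ n m → 1 ≤ n → n ≤ M → 1 ≤ m → DplusRow σ n m ≡ primitiveAt n m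
  DplusRow-primitive false n m 1≤n n≤M _ = ring (ℕ→ℚ m) (W₀ n) (W₁ n) (Φ (ℕ→ℚ n) m) (Φ (ℕ→ℚ n - 1ℚ) m)
    where ring : ∀ m a b X Y → m * a * (1ℚ * a * X) + m * b * ((- 1ℚ) * b * Y) ≡ m * (a * a * X - b * b * Y)
          ring = solve-∀ ringℚ
  DplusRow-primitive true n (suc j) 1≤n n≤M _ = trans (ring (ℕ→ℚ (suc j)) (W₀ n) (W₁ n) (Ψ₀ (ℕ→ℚ n) (suc j)) (Ψ₁ (ℕ→ℚ n - 1ℚ) (suc j)))
    (cong (ℕ→ℚ (suc j) *_) (Ψ-cross (ℕ→ℚ n) j (W₀ n) (W₁ n) (W₀-inv n 1≤n) (W₁-inv n 1≤n n≤M)))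
    where ring : ∀ m a b X Y → m * 1ℚ * (a * a * a) * X + m * (- 1ℚ) * (b * b * b) * Y ≡ m * (a * a * a * X - b * b * b * Y)
          ring = solve-∀ ringℚ

  Φ-primitive-top : ∀ n → 1 ≤ n → n ≤ M → primitiveAt n (suc M) ≡ 0ℚ
  Φ-primitive-top n 1≤n n≤M = trans (cong₂ (λ y z → ℕ→ℚ (suc M) * (W₀ n * W₀ n * y - W₁ n * W₁ n * z))
      (Φ-vanish n (suc M) (s≤s n≤M)) (trans (cong (λ z → Φ z (suc M)) (xₛ≡Kₛ true n 1≤n)) (Φ-vanish (pred n) (suc M) (ℕₚ.<-≤-trans (pred< n 1≤n) (ℕₚ.m≤n⇒m≤1+n n≤M)))))
    (ring (ℕ→ℚ (suc M)) (W₀ n) (W₁ n))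
    where ring : ∀ m a b → m * (a * a * 0ℚ - b * b * 0ℚ) ≡ 0ℚ
          ring = solve-∀ ringℚ

  Φ-telescope-top : ∀ n → 1 ≤ n → n ≤ M →
    W₀ n * Φ (ℕ→ℚ n) M - W₁ n * Φ (ℕ→ℚ n - 1ℚ) M ≡ primitiveAt n M - primitiveAt n (suc M)
  Φ-telescope-top n 1≤n n≤M = begin
    a * X - b * Y
      ≡⟨ cong (λ z → a * X - b * z) Y≡0 ⟩
    a * X - b * 0ℚ
      ≡⟨ top-term ⟩
    ℕ→ℚ M * (a * a * X - b * b * 0ℚ) - 0ℚ
      ≡⟨ cong₂ (λ y z → ℕ→ℚ M * (a * a * X - b * b * y) - z) (sym Y≡0) (sym (Φ-primitive-top n 1≤n n≤M)) ⟩
    primitiveAt n M - primitiveAt n (suc M) ∎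
    where
    open ≡-Reasoning
    a = W₀ n
    b = W₁ n
    X = Φ (ℕ→ℚ n) M
    Y = Φ (ℕ→ℚ n - 1ℚ) M
    Y≡0 : Y ≡ 0ℚ
    Y≡0 = trans (cong (λ z → Φ z M) (xₛ≡Kₛ true n 1≤n)) (Φ-vanish (pred n) M (ℕₚ.<-≤-trans (pred< n 1≤n) n≤M))
    ring₀ : ∀ a b m → a * 0ℚ - b * 0ℚ ≡ m * (a * a * 0ℚ - b * b * 0ℚ) - 0ℚ
    ring₀ = solve-∀ ringℚ
    ring₁ : ∀ a b m X → m * (a * a * X - b * b * 0ℚ) - 0ℚ ≡ (a * m) * (a * X) - b * 0ℚ
    ring₁ = solve-∀ ringℚ
    ring₂ : ∀ y z → 1ℚ * y - z ≡ y - z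
    ring₂ = solve-∀ ringℚ
    top-term : a * X - b * 0ℚ ≡ ℕ→ℚ M * (a * a * X - b * b * 0ℚ) - 0ℚ
    top-term with ℕₚ.m≤n⇒m<n∨m≡n n≤M
    ... | inj₁ n<M = trans (cong (λ z → a * z - b * 0ℚ) (Φ-vanish n M n<M))
                       (trans (ring₀ a b (ℕ→ℚ M)) (cong (λ z → ℕ→ℚ M * (a * a * z - b * b * 0ℚ) - 0ℚ) (sym (Φ-vanish n M n<M))))
    ... | inj₂ eq = sym (trans (ring₁ a b (ℕ→ℚ M) X) (trans (cong (λ z → z * (a * X) - b * 0ℚ)
                        (trans (cong (λ k → W₀ n * ℕ→ℚ k) (sym eq)) (W₀-inv n 1≤n))) (ring₂ (a * X) (b * 0ℚ))))

  Φ-telescope-W : ∀ n i → 1 ≤ n → n ≤ M → 1 ≤ i → i ≤ M →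
    W₀ n * Φ (ℕ→ℚ n) i - W₁ n * Φ (ℕ→ℚ n - 1ℚ) i ≡ primitiveAt n i - primitiveAt n (suc i)
  Φ-telescope-W n (suc j) 1≤n n≤M _ i≤M with ℕₚ.m≤n⇒m<n∨m≡n i≤M
  ... | inj₁ i<M = Φ-telescope (ℕ→ℚ n) j (W₀ n) (W₁ n) (W₀-inv n 1≤n) (W₁-inv n 1≤n n≤M) (falling-u≢0 (suc (suc j)) i<M)
  ... | inj₂ eq = subst (λ i → W₀ n * Φ (ℕ→ℚ n) i - W₁ n * Φ (ℕ→ℚ n - 1ℚ) i ≡ primitiveAt n i - primitiveAt n (suc i)) (sym eq) (Φ-telescope-top n 1≤n n≤M)

  sumFrom-Φ-step : ∀ K m → suc K ≤ M → 1 ≤ m → m ≤ suc M →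
    sumFrom m M (ΦW (suc K)) ≡ sumFrom m M (ΦW K) + primitiveAt (suc K) m
  sumFrom-Φ-step K m K<M p q = begin
    sumFrom m M (λ m' → W₀ m' * Φ x m')
      ≡⟨ ring₁ (sumFrom m M (λ m' → W₀ m' * Φ x m')) (sumFrom m M (ΦW K)) ⟩
    sumFrom m M (ΦW K) + (sumFrom m M (λ m' → W₀ m' * Φ x m') - sumFrom m M (ΦW K))
      ≡⟨ cong (sumFrom m M (ΦW K) +_) (sym (sumFrom-- m M _ _)) ⟩
    sumFrom m M (ΦW K) + sumFrom m M (λ m' → W₀ m' * Φ x m' - W₀ m' * Φ (ℕ→ℚ K) m')
      ≡⟨ cong (sumFrom m M (ΦW K) +_) (sumFrom-cong m M _ (λ m' → W₀ (suc K) * Φ x m' - W₁ (suc K) * Φ (x - 1ℚ) m')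
            (λ m' mm' m'M → trans (cong (λ z → W₀ m' * Φ x m' - W₀ m' * Φ z m') (sym (ℕ→ℚ-suc-1 K))) (Φ-difference-W (suc K) m' (s≤s z≤n) K<M (ℕₚ.≤-trans p mm')))) ⟩
    sumFrom m M (ΦW K) + sumFrom m M (λ m' → W₀ (suc K) * Φ x m' - W₁ (suc K) * Φ (x - 1ℚ) m')
      ≡⟨ cong (sumFrom m M (ΦW K) +_) (sumFrom-telescope m M (primitiveAt (suc K)) _ p q (λ i mi iM → Φ-telescope-W (suc K) i (s≤s z≤n) K<M (ℕₚ.≤-trans p mi) iM)) ⟩
    sumFrom m M (ΦW K) + (primitiveAt (suc K) m - primitiveAt (suc K) (suc M))
      ≡⟨ cong (λ z → sumFrom m M (ΦW K) + (primitiveAt (suc K) m - z)) (Φ-primitive-top (suc K) (s≤s z≤n) K<M) ⟩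
    sumFrom m M (ΦW K) + (primitiveAt (suc K) m - 0ℚ)
      ≡⟨ cong (sumFrom m M (ΦW K) +_) (+-identityʳ (primitiveAt (suc K) m)) ⟩
    sumFrom m M (ΦW K) + primitiveAt (suc K) m ∎
    where
    open ≡-Reasoning
    x = ℕ→ℚ (suc K)
    ring₁ : ∀ a b → a ≡ b + (a - b)
    ring₁ = solve-∀ ringℚ

  sumFrom-Φ-0 : ∀ m → sumFrom m M (ΦW 0) ≡ 0ℚ
  sumFrom-Φ-0 m = sumFrom-zero m M _ (λ i p q → trans (cong (W₀ i *_) (Φ-vanish 0 i p)) (*-zeroʳ (W₀ i)))

  sumTo-DplusRow : ∀ K σ m → K ≤ M → 1 ≤ m → m ≤ M → sumTo K (λ n → DplusRow σ n m) ≡ sumFrom m M (ΦW K)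
  sumTo-DplusRow zero σ m _ 1≤m m≤M = sym (sumFrom-Φ-0 m)
  sumTo-DplusRow (suc K) σ m K<M 1≤m m≤M = begin
    sumTo K (λ n → DplusRow σ n m) + DplusRow σ (suc K) m
      ≡⟨ cong₂ _+_ (sumTo-DplusRow K σ m (ℕₚ.<⇒≤ K<M) 1≤m m≤M) (DplusRow-primitive σ (suc K) m (s≤s z≤n) K<M 1≤m) ⟩
    sumFrom m M (ΦW K) + primitiveAt (suc K) m
      ≡⟨ sym (sumFrom-Φ-step K m K<M 1≤m (ℕₚ.m≤n⇒m≤1+n m≤M)) ⟩
    sumFrom m M (ΦW (suc K)) ∎
    where open ≡-Reasoning

  Φ-primitive-1-W : ∀ n → 1 ≤ n → n ≤ M → primitiveAt n 1 ≡ W₀ n - W₁ n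
  Φ-primitive-1-W n 1≤n n≤M = trans (*-identityˡ (W₀ n * W₀ n * Φ (ℕ→ℚ n) 1 - W₁ n * W₁ n * Φ (ℕ→ℚ n - 1ℚ) 1))
    (Φ-primitive-1 (ℕ→ℚ n) (W₀ n) (W₁ n) (W₀-inv n 1≤n) (W₁-inv n 1≤n n≤M) (u≢0 (ℕₚ.≤-trans 1≤n n≤M)))

  sumTo-W-difference : ∀ K → K ≤ M → sumTo K (λ n → W₀ n - W₁ n) ≡ sumTo M (ΦW K)
  sumTo-W-difference zero _ = sym (trans (sym (sumFrom-1 M _)) (sumFrom-Φ-0 1))
  sumTo-W-difference (suc K) K<M = begin
    sumTo K (λ n → W₀ n - W₁ n) + (W₀ (suc K) - W₁ (suc K))
      ≡⟨ cong₂ _+_ (sumTo-W-difference K (ℕₚ.<⇒≤ K<M)) (sym (Φ-primitive-1-W (suc K) (s≤s z≤n) K<M)) ⟩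
    sumTo M (ΦW K) + primitiveAt (suc K) 1
      ≡⟨ cong (_+ primitiveAt (suc K) 1) (sym (sumFrom-1 M _)) ⟩
    sumFrom 1 M (ΦW K) + primitiveAt (suc K) 1
      ≡⟨ sym (sumFrom-Φ-step K 1 K<M (s≤s z≤n) (s≤s z≤n)) ⟩
    sumFrom 1 M (ΦW (suc K))
      ≡⟨ sumFrom-1 M _ ⟩
    sumTo M (ΦW (suc K)) ∎
    where open ≡-Reasoning

  sumTo-okF : ∀ τ' n' (g : ℕ → ℚ) → 1 ≤ n' → n' ≤ M → sumTo M (λ n → ind (okF τ' n n') * g n) ≡ sumTo (Kₛ τ' n') g
  sumTo-okF false n' g 1≤n' n'≤M = trans (sumTo-cong M _ _ (λ n _ _ → ind-if (n ≤ᵇ n') (g n))) (sumTo-upTo M n' g n'≤M)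
  sumTo-okF true (suc k) g 1≤n' n'≤M = trans (sumTo-cong M _ _ (λ n _ _ → ind-if (n ≤ᵇ k) (g n))) (sumTo-upTo M k g (ℕₚ.<⇒≤ n'≤M))

  sumStates-okF : ∀ τ' n' c (h : Bool → ℕ → ℚ) → 1 ≤ n' → n' ≤ M →
    sumStates (λ τ n → h τ n * (ind (okF τ' n n') * c)) ≡ sumTo (Kₛ τ' n') (λ n → h false n + h true n) * c
  sumStates-okF τ' n' c h 1≤n' n'≤M = begin
    sumStates (λ τ n → h τ n * (ind (okF τ' n n') * c))
      ≡⟨ sumTo-cong M _ (λ n → ind (okF τ' n n') * (h false n + h true n) * c) (λ n _ _ → ring (h false n) (h true n) (ind (okF τ' n n')) c) ⟩
    sumTo M (λ n → ind (okF τ' n n') * (h false n + h true n) * c)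
      ≡⟨ sumTo-cong M _ (λ n → c * (ind (okF τ' n n') * (h false n + h true n))) (λ n _ _ → *-comm (ind (okF τ' n n') * (h false n + h true n)) c) ⟩
    sumTo M (λ n → c * (ind (okF τ' n n') * (h false n + h true n)))
      ≡⟨ sumTo-* M c _ ⟩
    c * sumTo M (λ n → ind (okF τ' n n') * (h false n + h true n))
      ≡⟨ cong (c *_) (sumTo-okF τ' n' (λ n → h false n + h true n) 1≤n' n'≤M) ⟩
    c * sumTo (Kₛ τ' n') (λ n → h false n + h true n)
      ≡⟨ *-comm c _ ⟩
    sumTo (Kₛ τ' n') (λ n → h false n + h true n) * c ∎
    where
    open ≡-Reasoning
    ring : ∀ a b i c → a * (i * c) + b * (i * c) ≡ i * (a + b) * c
    ring = solve-∀ ringℚ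

  signedW : Bool → ℕ → ℚ
  signedW τ' n' = sg τ' * W τ' n'

  kernelF : Bool → ℕ → Bool → ℕ → ℚ
  kernelF τ n τ' n' = ind (okF τ' n n') * signedW τ' n'

  connect-stepF-ff : ∀ v σ m → 1 ≤ m → m ≤ M → connect false (stepF false v) σ m ≡ stepG true (connect false v) σ m
  connect-stepF-ff v true m 1≤m m≤M = sumStates-zero (λ τ n → connector false true m τ n * stepF false v τ n) (λ τ n _ _ → *-zeroˡ (stepF false v τ n))
  connect-stepF-ff v false m 1≤m m≤M = begin
    sumStates (λ τ n → Dcomma τ n m * sumStates (λ τ' n' → kernelF τ n τ' n' * v τ' n'))
      ≡⟨ sumStates-assoc (λ τ n → Dcomma τ n m) kernelF v ⟩
    sumStates (λ τ' n' → sumStates (λ τ n → Dcomma τ n m * kernelF τ n τ' n') * v τ' n')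
      ≡⟨ sumStates-cong (λ τ' n' → sumStates (λ τ n → Dcomma τ n m * kernelF τ n τ' n') * v τ' n') (λ τ' n' → W₀ m * (Dcomma τ' n' m * v τ' n')) (λ τ' n' p' q' → column τ' n' p' q') ⟩
    sumStates (λ τ' n' → W₀ m * (Dcomma τ' n' m * v τ' n'))
      ≡⟨ sumStates-* (W₀ m) (λ τ' n' → Dcomma τ' n' m * v τ' n') ⟩
    W₀ m * sumStates (λ τ' n' → Dcomma τ' n' m * v τ' n') ∎
    where
    open ≡-Reasoning
    ring : ∀ c φ k vv → c * φ * k * vv ≡ c * (k * φ * vv)
    ring = solve-∀ ringℚ
    column : ∀ τ' n' → 1 ≤ n' → n' ≤ M → sumStates (λ τ n → Dcomma τ n m * kernelF τ n τ' n') * v τ' n' ≡ W₀ m * (Dcomma τ' n' m * v τ' n')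
    column τ' n' p' q' = begin
      sumStates (λ τ n → Dcomma τ n m * kernelF τ n τ' n') * v τ' n'
        ≡⟨ cong (_* v τ' n') (sumStates-okF τ' n' (signedW τ' n') (λ τ n → Dcomma τ n m) p' q') ⟩
      sumTo (Kₛ τ' n') (λ n → Dcomma false n m + Dcomma true n m) * signedW τ' n' * v τ' n'
        ≡⟨ cong (λ z → z * signedW τ' n' * v τ' n') (sumTo-Dcomma (Kₛ τ' n') m (Kₛ≤M τ' n' q') 1≤m m≤M) ⟩
      W₀ m * Φ (ℕ→ℚ (Kₛ τ' n')) m * signedW τ' n' * v τ' n'
        ≡⟨ ring (W₀ m) (Φ (ℕ→ℚ (Kₛ τ' n')) m) (signedW τ' n') (v τ' n') ⟩
      W₀ m * (signedW τ' n' * Φ (ℕ→ℚ (Kₛ τ' n')) m * v τ' n')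
        ≡⟨ cong (λ z → W₀ m * (signedW τ' n' * Φ z m * v τ' n')) (sym (xₛ≡Kₛ τ' n' p')) ⟩
      W₀ m * (Dcomma τ' n' m * v τ' n') ∎

  connect-stepF-ft : ∀ v σ m → 1 ≤ m → m ≤ M → connect false (stepF true v) σ m ≡ stepG true (connect true v) σ m
  connect-stepF-ft v true m 1≤m m≤M = sumStates-zero (λ τ n → connector false true m τ n * stepF true v τ n) (λ τ n _ _ → *-zeroˡ (stepF true v τ n))
  connect-stepF-ft v false m 1≤m m≤M = trans (sumStates-cong (λ τ n → connector false false m τ n * stepF true v τ n) (λ τ n → W₀ m * (Dplus₀ τ n m * v τ n)) column) (sumStates-* (W₀ m) (λ τ n → Dplus₀ τ n m * v τ n))
    where
    ring₁ : ∀ c mq w d vv → c * (mq * w * d * vv) ≡ (c * mq) * (d * (w * vv))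
    ring₁ = solve-∀ ringℚ
    column : ∀ τ n → 1 ≤ n → n ≤ M → Dcomma τ n m * (W τ n * v τ n) ≡ W₀ m * (Dplus₀ τ n m * v τ n)
    column τ n _ _ = sym (trans (ring₁ (W₀ m) (ℕ→ℚ m) (W τ n) (Dcomma τ n m) (v τ n))
                   (trans (cong (_* (Dcomma τ n m * (W τ n * v τ n))) (W₀-inv m 1≤m)) (*-identityˡ _)))

  Dplus-column : ∀ σ m τ n → 1 ≤ m → m ≤ M → 1 ≤ n → n ≤ M →
    sumStates (λ σ' m' → (ind (okG σ σ' m m') * W σ' m') * connector true σ' m' τ n) ≡ connector true σ m τ n * W τ n
  Dplus-column true m τ n 1≤m m≤M 1≤n n≤M = begin
    sumTo M (λ m' → (ind (m ≤ᵇ m') * W₀ m') * Dplus₀ τ n m' + (ind (m ≤ᵇ m') * W₁ m') * Dplus₁ τ n m')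
      ≡⟨ sumTo-cong M _ _ (λ m' _ _ → trans (ind-+ (m ≤ᵇ m') (W₀ m') (Dplus₀ τ n m') (m ≤ᵇ m') (W₁ m') (Dplus₁ τ n m'))
                                            (sym (if-+ (m ≤ᵇ m') _ _))) ⟩
    sumFrom m M (WDplus τ n)
      ≡⟨ sumFrom-WDplus τ n m 1≤n n≤M 1≤m (ℕₚ.m≤n⇒m≤1+n m≤M) ⟩
    Dplus₁ τ n m * W τ n ∎
    where open ≡-Reasoning
  Dplus-column false m τ n 1≤m m≤M 1≤n n≤M = begin
    sumTo M (λ m' → (ind (m ≤ᵇ m') * W₀ m') * Dplus₀ τ n m' + (ind (m <ᵇ m') * W₁ m') * Dplus₁ τ n m')
      ≡⟨ sumTo-cong M _ _ (λ m' _ _ → ind-+ (m ≤ᵇ m') (W₀ m') (Dplus₀ τ n m') (suc m ≤ᵇ m') (W₁ m') (Dplus₁ τ n m')) ⟩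
    sumTo M (λ m' → (if m ≤ᵇ m' then W₀ m' * Dplus₀ τ n m' else 0ℚ) + (if suc m ≤ᵇ m' then W₁ m' * Dplus₁ τ n m' else 0ℚ))
      ≡⟨ sumTo-+ M _ _ ⟩
    S₀ + sumFrom (suc m) M (λ m' → W₁ m' * Dplus₁ τ n m')
      ≡⟨ add-sub S₀ (sumFrom (suc m) M (λ m' → W₁ m' * Dplus₁ τ n m')) (W₁ m * Dplus₁ τ n m) ⟩
    (S₀ + (W₁ m * Dplus₁ τ n m + sumFrom (suc m) M (λ m' → W₁ m' * Dplus₁ τ n m'))) - W₁ m * Dplus₁ τ n m
      ≡⟨ cong (λ z → (S₀ + z) - W₁ m * Dplus₁ τ n m) (sym (sumFrom-split m M _ 1≤m m≤M)) ⟩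
    (S₀ + sumFrom m M (λ m' → W₁ m' * Dplus₁ τ n m')) - W₁ m * Dplus₁ τ n m
      ≡⟨ cong (_- W₁ m * Dplus₁ τ n m) (sym (sumFrom-+ m M _ _)) ⟩
    sumFrom m M (WDplus τ n) - W₁ m * Dplus₁ τ n m
      ≡⟨ cong (_- W₁ m * Dplus₁ τ n m) (sumFrom-WDplus τ n m 1≤n n≤M 1≤m (ℕₚ.m≤n⇒m≤1+n m≤M)) ⟩
    Dplus₁ τ n m * W τ n - W₁ m * Dplus₁ τ n m
      ≡⟨ factor (ℕ→ℚ m) (sg τ) (W τ n) (Ψₛ τ n m) (W₁ m) ⟩
    ℕ→ℚ m * W τ n * (sg τ * W τ n * (Ψₛ τ n m * (W τ n - W₁ m))) * W τ n
      ≡⟨ cong (λ z → ℕ→ℚ m * W τ n * (sg τ * W τ n * z) * W τ n) (Ψₛ-difference τ n m 1≤n n≤M 1≤m m≤M) ⟩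
    Dplus₀ τ n m * W τ n ∎
    where
    open ≡-Reasoning
    S₀ = sumFrom m M (λ m' → W₀ m' * Dplus₀ τ n m')
    add-sub : ∀ a b c → a + b ≡ (a + (c + b)) - c
    add-sub = solve-∀ ringℚ
    factor : ∀ k s w Ψ v → k * s * (w * w * w) * Ψ * w - v * (k * s * (w * w * w) * Ψ) ≡ k * w * (s * w * (Ψ * (w - v))) * w
    factor = solve-∀ ringℚ

  connect-stepF-tt : ∀ v σ m → 1 ≤ m → m ≤ M → connect true (stepF true v) σ m ≡ stepG false (connect true v) σ m
  connect-stepF-tt v σ m 1≤m m≤M = begin
    sumStates (λ τ n → connector true σ m τ n * (W τ n * v τ n))
      ≡⟨ sumStates-cong _ _ (λ τ n 1≤n n≤M →
           trans (sym (*-assoc (connector true σ m τ n) (W τ n) (v τ n)))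
                 (cong (_* v τ n) (sym (Dplus-column σ m τ n 1≤m m≤M 1≤n n≤M)))) ⟩
    sumStates (λ τ n → sumStates (λ σ' m' → (ind (okG σ σ' m m') * W σ' m') * connector true σ' m' τ n) * v τ n)
      ≡⟨ sym (sumStates-assoc (λ σ' m' → ind (okG σ σ' m m') * W σ' m') (λ σ' m' τ n → connector true σ' m' τ n) v) ⟩
    sumStates (λ σ' m' → (ind (okG σ σ' m m') * W σ' m') * sumStates (λ τ n → connector true σ' m' τ n * v τ n)) ∎
    where open ≡-Reasoning

  sumStates-Dcomma : ∀ σ m τ' n' → 1 ≤ n' → n' ≤ M →
    sumStates (λ σ' m' → (ind (okG σ σ' m m') * W σ' m') * connector false σ' m' τ' n') ≡ signedW τ' n' * sumFrom m M (ΦW (Kₛ τ' n'))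
  sumStates-Dcomma σ m τ' n' 1≤n' n'≤M = begin
    sumTo M (λ m' → (ind (okG σ false m m') * W₀ m') * Dcomma τ' n' m' + (ind (okG σ true m m') * W₁ m') * 0ℚ)
      ≡⟨ sumTo-cong M _ (λ m' → signedW τ' n' * (if m ≤ᵇ m' then W₀ m' * Φ (ℕ→ℚ (Kₛ τ' n')) m' else 0ℚ)) (λ m' _ _ → term m') ⟩
    sumTo M (λ m' → signedW τ' n' * (if m ≤ᵇ m' then W₀ m' * Φ (ℕ→ℚ (Kₛ τ' n')) m' else 0ℚ))
      ≡⟨ sumTo-* M (signedW τ' n') _ ⟩
    signedW τ' n' * sumFrom m M (ΦW (Kₛ τ' n')) ∎
    where
    open ≡-Reasoning
    ring : ∀ i w k φ j w1 → (i * w) * (k * φ) + (j * w1) * 0ℚ ≡ k * (i * (w * φ))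
    ring = solve-∀ ringℚ
    term : ∀ m' → (ind (okG σ false m m') * W₀ m') * Dcomma τ' n' m' + (ind (okG σ true m m') * W₁ m') * 0ℚ
               ≡ signedW τ' n' * (if m ≤ᵇ m' then W₀ m' * Φ (ℕ→ℚ (Kₛ τ' n')) m' else 0ℚ)
    term m' = trans (ring (ind (okG σ false m m')) (W₀ m') (signedW τ' n') (Φ (xₛ τ' n') m') (ind (okG σ true m m')) (W₁ m'))
      (cong (signedW τ' n' *_) (trans (cong₂ (λ b z → ind b * (W₀ m' * Φ z m')) (okG-false σ m m') (xₛ≡Kₛ τ' n' 1≤n')) (ind-if (m ≤ᵇ m') _)))

  connect-stepF-tf : ∀ v σ m → 1 ≤ m → m ≤ M → connect true (stepF false v) σ m ≡ stepG false (connect false v) σ m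
  connect-stepF-tf v σ m 1≤m m≤M = begin
    sumStates (λ τ n → connector true σ m τ n * sumStates (λ τ' n' → kernelF τ n τ' n' * v τ' n'))
      ≡⟨ sumStates-assoc (λ τ n → connector true σ m τ n) kernelF v ⟩
    sumStates (λ τ' n' → sumStates (λ τ n → connector true σ m τ n * kernelF τ n τ' n') * v τ' n')
      ≡⟨ sumStates-cong (λ τ' n' → sumStates (λ τ n → connector true σ m τ n * kernelF τ n τ' n') * v τ' n') (λ τ' n' → sumStates (λ σ' m' → (ind (okG σ σ' m m') * W σ' m') * connector false σ' m' τ' n') * v τ' n') (λ τ' n' p' q' → cong (_* v τ' n') (column τ' n' p' q')) ⟩
    sumStates (λ τ' n' → sumStates (λ σ' m' → (ind (okG σ σ' m m') * W σ' m') * connector false σ' m' τ' n') * v τ' n')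
      ≡⟨ sym (sumStates-assoc (λ σ' m' → ind (okG σ σ' m m') * W σ' m') (λ σ' m' τ' n' → connector false σ' m' τ' n') v) ⟩
    sumStates (λ σ' m' → (ind (okG σ σ' m m') * W σ' m') * sumStates (λ τ' n' → connector false σ' m' τ' n' * v τ' n')) ∎
    where
    open ≡-Reasoning
    DplusRow-def : ∀ σ n → connector true σ m false n + connector true σ m true n ≡ DplusRow σ n m
    DplusRow-def false n = refl
    DplusRow-def true n = refl
    column : ∀ τ' n' → 1 ≤ n' → n' ≤ M → sumStates (λ τ n → connector true σ m τ n * kernelF τ n τ' n') ≡ sumStates (λ σ' m' → (ind (okG σ σ' m m') * W σ' m') * connector false σ' m' τ' n')
    column τ' n' p' q' = begin
      sumStates (λ τ n → connector true σ m τ n * kernelF τ n τ' n')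
        ≡⟨ sumStates-okF τ' n' (signedW τ' n') (λ τ n → connector true σ m τ n) p' q' ⟩
      sumTo (Kₛ τ' n') (λ n → connector true σ m false n + connector true σ m true n) * signedW τ' n'
        ≡⟨ cong (_* signedW τ' n') (trans (sumTo-cong (Kₛ τ' n') _ _ (λ n _ _ → DplusRow-def σ n)) (sumTo-DplusRow (Kₛ τ' n') σ m (Kₛ≤M τ' n' q') 1≤m m≤M)) ⟩
      sumFrom m M (ΦW (Kₛ τ' n')) * signedW τ' n'
        ≡⟨ *-comm (sumFrom m M (ΦW (Kₛ τ' n'))) (signedW τ' n') ⟩
      signedW τ' n' * sumFrom m M (ΦW (Kₛ τ' n'))
        ≡⟨ sym (sumStates-Dcomma σ m τ' n' p' q') ⟩
      sumStates (λ σ' m' → (ind (okG σ σ' m m') * W σ' m') * connector false σ' m' τ' n') ∎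

  connect-stepF : ∀ β b v σ m → 1 ≤ m → m ≤ M → connect β (stepF b v) σ m ≡ stepG (not β) (connect b v) σ m
  connect-stepF false false = connect-stepF-ff
  connect-stepF false true = connect-stepF-ft
  connect-stepF true true = connect-stepF-tt
  connect-stepF true false = connect-stepF-tf

  start-Dplus-column : ∀ τ n → 1 ≤ n → n ≤ M → sg τ * W τ n * W τ n ≡ sumStates (λ σ m → W σ m * connector true σ m τ n)
  start-Dplus-column τ n 1≤n n≤M = begin
    sg τ * W τ n * W τ n
      ≡⟨ split (sg τ) (W τ n) (Ψₛ τ n 1) ⟩
    Dplus-primitive τ n 1 + sg τ * W τ n * W τ n * (1ℚ - W τ n * W τ n * Ψₛ τ n 1)
      ≡⟨ cong (λ z → Dplus-primitive τ n 1 + sg τ * W τ n * W τ n * (1ℚ - z)) (Ψₛ-1 τ n 1≤n n≤M) ⟩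
    Dplus-primitive τ n 1 + sg τ * W τ n * W τ n * (1ℚ - 1ℚ)
      ≡⟨ drop (Dplus-primitive τ n 1) (sg τ * W τ n * W τ n) ⟩
    Dplus-primitive τ n 1
      ≡⟨ sym (sumFrom-WDplus τ n 1 1≤n n≤M (s≤s z≤n) (s≤s z≤n)) ⟩
    sumFrom 1 M (WDplus τ n)
      ≡⟨ sumFrom-1 M _ ⟩
    sumTo M (WDplus τ n) ∎
    where
    open ≡-Reasoning
    split : ∀ s w Ψ → s * w * w ≡ 1ℚ * s * (w * w * w) * Ψ * w + s * w * w * (1ℚ - w * w * Ψ)
    split = solve-∀ ringℚ
    drop : ∀ e c → e + c * (1ℚ - 1ℚ) ≡ e
    drop = solve-∀ ringℚ

  start-Dcomma-column : ∀ τ' n' → 1 ≤ n' → n' ≤ M →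
    sumStates (λ τ n → sg τ * W τ n * kernelF τ n τ' n') ≡ sumStates (λ σ m → W σ m * connector false σ m τ' n')
  start-Dcomma-column τ' n' 1≤n' n'≤M = begin
    sumStates (λ τ n → sg τ * W τ n * kernelF τ n τ' n')
      ≡⟨ sumStates-okF τ' n' (signedW τ' n') (λ τ n → sg τ * W τ n) 1≤n' n'≤M ⟩
    sumTo (Kₛ τ' n') (λ n → 1ℚ * W₀ n + - 1ℚ * W₁ n) * signedW τ' n'
      ≡⟨ cong (_* signedW τ' n') (trans (sumTo-cong (Kₛ τ' n') _ _ (λ n _ _ → signed-sum (W₀ n) (W₁ n)))
                                        (sumTo-W-difference (Kₛ τ' n') (Kₛ≤M τ' n' n'≤M))) ⟩
    sumTo M (ΦW (Kₛ τ' n')) * signedW τ' n'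
      ≡⟨ *-comm (sumTo M (ΦW (Kₛ τ' n'))) (signedW τ' n') ⟩
    signedW τ' n' * sumTo M (ΦW (Kₛ τ' n'))
      ≡⟨ sym (sumTo-* M (signedW τ' n') _) ⟩
    sumTo M (λ m → signedW τ' n' * (W₀ m * Φ (ℕ→ℚ (Kₛ τ' n')) m))
      ≡⟨ sumTo-cong M _ _ (λ m _ _ → sym (trans (regroup (W₀ m) (signedW τ' n') (Φ (xₛ τ' n') m) (W₁ m))
                                                (cong (λ z → signedW τ' n' * (W₀ m * Φ z m)) (xₛ≡Kₛ τ' n' 1≤n')))) ⟩
    sumStates (λ σ m → W σ m * connector false σ m τ' n') ∎
    where
    open ≡-Reasoning
    signed-sum : ∀ a b → 1ℚ * a + - 1ℚ * b ≡ a - b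
    signed-sum = solve-∀ ringℚ
    regroup : ∀ w k φ w₁ → w * (k * φ) + w₁ * 0ℚ ≡ k * (w * φ)
    regroup = solve-∀ ringℚ

  start-stepF : ∀ b v → sumStates (λ τ n → sg τ * W τ n * stepF b v τ n) ≡ sumStates (λ σ m → W σ m * connect b v σ m)
  start-stepF true v = begin
    sumStates (λ τ n → sg τ * W τ n * (W τ n * v τ n))
      ≡⟨ sumStates-cong _ _ (λ τ n 1≤n n≤M →
           trans (sym (*-assoc (sg τ * W τ n) (W τ n) (v τ n))) (cong (_* v τ n) (start-Dplus-column τ n 1≤n n≤M))) ⟩
    sumStates (λ τ n → sumStates (λ σ m → W σ m * connector true σ m τ n) * v τ n)
      ≡⟨ sym (sumStates-assoc W (λ σ m τ n → connector true σ m τ n) v) ⟩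
    sumStates (λ σ m → W σ m * connect true v σ m) ∎
    where open ≡-Reasoning
  start-stepF false v = begin
    sumStates (λ τ n → sg τ * W τ n * sumStates (λ τ' n' → kernelF τ n τ' n' * v τ' n'))
      ≡⟨ sumStates-assoc (λ τ n → sg τ * W τ n) kernelF v ⟩
    sumStates (λ τ' n' → sumStates (λ τ n → sg τ * W τ n * kernelF τ n τ' n') * v τ' n')
      ≡⟨ sumStates-cong _ _ (λ τ' n' 1≤n' n'≤M → cong (_* v τ' n') (start-Dcomma-column τ' n' 1≤n' n'≤M)) ⟩
    sumStates (λ τ' n' → sumStates (λ σ m → W σ m * connector false σ m τ' n') * v τ' n')
      ≡⟨ sym (sumStates-assoc W (λ σ m τ n → connector false σ m τ n) v) ⟩
    sumStates (λ σ m → W σ m * connect false v σ m) ∎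
    where open ≡-Reasoning

  connect-end : ∀ β σ m → 1 ≤ m → m ≤ M → connect β endF σ m ≡ stepG (not β) endG σ m
  connect-end false true m 1≤m m≤M = sumStates-zero (λ τ n → connector false true m τ n * endF τ n) (λ _ _ _ _ → ring)
    where ring : 0ℚ * 1ℚ ≡ 0ℚ
          ring = solve-∀ ringℚ
  connect-end false false m 1≤m m≤M = trans (sumTo-cong M _ _ (λ n _ _ → ring (Dcomma false n m) (Dcomma true n m))) (sumTo-Dcomma M m ℕₚ.≤-refl 1≤m m≤M)
    where ring : ∀ a b → a * 1ℚ + b * 1ℚ ≡ a + b
          ring = solve-∀ ringℚ
  connect-end true σ m 1≤m m≤M = begin
    sumStates (λ τ n → connector true σ m τ n * 1ℚ)
      ≡⟨ sumTo-cong M _ _ (λ n _ _ → trans (ring (connector true σ m false n) (connector true σ m true n)) (DplusRow-def σ n)) ⟩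
    sumTo M (λ n → DplusRow σ n m)
      ≡⟨ sumTo-DplusRow M σ m ℕₚ.≤-refl 1≤m m≤M ⟩
    sumFrom m M (ΦW M)
      ≡⟨ sym (sumTo-cong M (λ m' → (ind (okG σ false m m') * W₀ m') * Φ (ℕ→ℚ M) m' + (ind (okG σ true m m') * W₁ m') * 0ℚ)
                           (λ m' → if m ≤ᵇ m' then W₀ m' * Φ (ℕ→ℚ M) m' else 0ℚ)
              (λ m' _ _ → trans (ring₃ (ind (okG σ false m m')) (ind (okG σ true m m')) (W₀ m') (W₁ m') (Φ (ℕ→ℚ M) m'))
                         (trans (cong (λ b → ind b * (W₀ m' * Φ (ℕ→ℚ M) m')) (okG-false σ m m')) (ind-if (m ≤ᵇ m') _)))) ⟩
    stepG false endG σ m ∎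
    where
    open ≡-Reasoning
    ring : ∀ a b → a * 1ℚ + b * 1ℚ ≡ a + b
    ring = solve-∀ ringℚ
    DplusRow-def : ∀ σ n → connector true σ m false n + connector true σ m true n ≡ DplusRow σ n m
    DplusRow-def false n = refl
    DplusRow-def true n = refl
    ring₃ : ∀ i j w0 w1 φ → (i * w0) * φ + (j * w1) * 0ℚ ≡ i * (w0 * φ)
    ring₃ = solve-∀ ringℚ

  start-end : sumStates (λ τ n → sg τ * W τ n * endF τ n) ≡ sumStates (λ σ m → W σ m * endG σ m)
  start-end = begin
    sumStates (λ τ n → sg τ * W τ n * 1ℚ)
      ≡⟨ sumTo-cong M _ _ (λ n _ _ → ring (W₀ n) (W₁ n)) ⟩
    sumTo M (λ n → W₀ n - W₁ n)
      ≡⟨ sumTo-W-difference M ℕₚ.≤-refl ⟩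
    sumTo M (ΦW M)
      ≡⟨ sumTo-cong M _ _ (λ m _ _ → ring₂ (W₀ m * Φ (ℕ→ℚ M) m) (W₁ m)) ⟩
    sumStates (λ σ m → W σ m * endG σ m) ∎
    where
    open ≡-Reasoning
    ring : ∀ a b → 1ℚ * a * 1ℚ + - 1ℚ * b * 1ℚ ≡ a - b
    ring = solve-∀ ringℚ
    ring₂ : ∀ a b → a ≡ a + b * 0ℚ
    ring₂ = solve-∀ ringℚ

  connect-suffix : ∀ m≤M b σ m → 1 ≤ m → m ≤ M → connect b (suffixF m≤M) σ m ≡ stepG (not b) (suffixG (map not m≤M)) σ m
  connect-suffix [] b σ m 1≤m m≤M = connect-end b σ m 1≤m m≤M
  connect-suffix (c ∷ q') b σ m 1≤m m≤M = trans (connect-stepF b c (suffixF q') σ m 1≤m m≤M)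
    (stepG-cong (not b) (connect c (suffixF q')) (suffixG (map not (c ∷ q'))) (λ σ' m' p' q'' → connect-suffix q' c σ' m' p' q'') σ m 1≤m m≤M)

  walk-duality : ∀ bs → walkF bs ≡ walkG (map not bs)
  walk-duality [] = start-end
  walk-duality (b ∷ q) = trans (start-stepF b (suffixF q)) (sumStates-cong (λ σ m → W σ m * connect b (suffixF q) σ m) (λ σ m → W σ m * stepG (not b) (suffixG (map not q)) σ m) (λ σ m p r → cong (W σ m *_) (connect-suffix q b σ m p r)))

Σℚ-++ : ∀ (xs ys : List ℚ) → Σℚ (xs ++ ys) ≡ Σℚ xs + Σℚ ys
Σℚ-++ [] ys = sym (+-identityˡ (Σℚ ys))
Σℚ-++ (x ∷ xs) ys = trans (cong (x +_) (Σℚ-++ xs ys)) (ring x (Σℚ xs) (Σℚ ys))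
  where ring : ∀ a b c → a + (b + c) ≡ (a + b) + c
        ring = solve-∀ ringℚ

Πℚ-++ : ∀ (xs ys : List ℚ) → Πℚ (xs ++ ys) ≡ Πℚ xs * Πℚ ys
Πℚ-++ [] ys = sym (*-identityˡ (Πℚ ys))
Πℚ-++ (x ∷ xs) ys = trans (cong (x *_) (Πℚ-++ xs ys)) (ring x (Πℚ xs) (Πℚ ys))
  where ring : ∀ a b c → a * (b * c) ≡ (a * b) * c
        ring = solve-∀ ringℚ

module _ {A : Set} where
  Σℚ-cong : ∀ (f g : A → ℚ) xs → (∀ x → f x ≡ g x) → Σℚ (map f xs) ≡ Σℚ (map g xs)
  Σℚ-cong f g [] h = refl
  Σℚ-cong f g (x ∷ xs) h = cong₂ _+_ (h x) (Σℚ-cong f g xs h)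

  Σℚ-* : ∀ c (f : A → ℚ) xs → Σℚ (map (λ x → c * f x) xs) ≡ c * Σℚ (map f xs)
  Σℚ-* c f [] = ring c
    where ring : ∀ c → 0ℚ ≡ c * 0ℚ
          ring = solve-∀ ringℚ
  Σℚ-* c f (x ∷ xs) = trans (cong (c * f x +_) (Σℚ-* c f xs)) (ring c (f x) (Σℚ (map f xs)))
    where ring : ∀ c a b → c * a + c * b ≡ c * (a + b)
          ring = solve-∀ ringℚ

  Σℚ-+ : ∀ (f g : A → ℚ) xs → Σℚ (map (λ x → f x + g x) xs) ≡ Σℚ (map f xs) + Σℚ (map g xs)
  Σℚ-+ f g [] = ring
    where ring : 0ℚ ≡ 0ℚ + 0ℚ
          ring = solve-∀ ringℚ
  Σℚ-+ f g (x ∷ xs) = trans (cong (f x + g x +_) (Σℚ-+ f g xs)) (ring (f x) (g x) (Σℚ (map f xs)) (Σℚ (map g xs)))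
    where ring : ∀ a b c d → a + b + (c + d) ≡ (a + c) + (b + d)
          ring = solve-∀ ringℚ

  Σℚ-zero : ∀ xs → Σℚ (map (λ (_ : A) → 0ℚ) xs) ≡ 0ℚ
  Σℚ-zero [] = refl
  Σℚ-zero (x ∷ xs) = trans (cong (0ℚ +_) (Σℚ-zero xs)) ring
    where ring : 0ℚ + 0ℚ ≡ 0ℚ
          ring = solve-∀ ringℚ

  Σℚ-if : ∀ c (f : A → ℚ) xs → (if c then Σℚ (map f xs) else 0ℚ) ≡ Σℚ (map (λ x → if c then f x else 0ℚ) xs)
  Σℚ-if true f xs = refl
  Σℚ-if false f xs = sym (Σℚ-zero xs)

module _ {A B : Set} where
  Σℚ-map-map : ∀ (f : B → ℚ) (h : A → B) xs → Σℚ (map f (map h xs)) ≡ Σℚ (map (λ x → f (h x)) xs)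
  Σℚ-map-map f h xs = cong Σℚ (sym (List.map-∘ xs))

  Σℚ-concatMap : ∀ (f : B → ℚ) (g : A → List B) xs → Σℚ (map f (concatMap g xs)) ≡ Σℚ (map (λ x → Σℚ (map f (g x))) xs)
  Σℚ-concatMap f g [] = refl
  Σℚ-concatMap f g (x ∷ xs) = trans (cong Σℚ (List.map-++ f (g x) (concatMap g xs)))
    (trans (Σℚ-++ (map f (g x)) (map f (concatMap g xs))) (cong (Σℚ (map f (g x)) +_) (Σℚ-concatMap f g xs)))

  Σℚ-swap : ∀ (f : A → B → ℚ) xs ys → Σℚ (map (λ x → Σℚ (map (λ y → f x y) ys)) xs) ≡ Σℚ (map (λ y → Σℚ (map (λ x → f x y) xs)) ys)
  Σℚ-swap f [] ys = sym (Σℚ-zero ys)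
  Σℚ-swap f (x ∷ xs) ys = trans (cong (Σℚ (map (λ y → f x y) ys) +_) (Σℚ-swap f xs ys))
    (sym (Σℚ-+ (λ y → f x y) (λ y → Σℚ (map (λ x → f x y) xs)) ys))

Σℚ-applyUpTo : ∀ (h : ℕ → ℚ) n → Σℚ (applyUpTo h n) ≡ sumTo n (λ i → h (ℕ.pred i))
Σℚ-applyUpTo h zero = refl
Σℚ-applyUpTo h (suc n) = begin
  Σℚ (applyUpTo h (suc n)) ≡⟨ cong Σℚ (sym (List.applyUpTo-∷ʳ h n)) ⟩
  Σℚ (applyUpTo h n ∷ʳ h n) ≡⟨ Σℚ-++ (applyUpTo h n) [ h n ] ⟩
  Σℚ (applyUpTo h n) + (h n + 0ℚ) ≡⟨ cong₂ _+_ (Σℚ-applyUpTo h n) (+-identityʳ (h n)) ⟩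
  sumTo n (λ i → h (ℕ.pred i)) + h n ∎
  where open ≡-Reasoning

Σℚ-range : ∀ (f : ℕ → ℚ) M → Σℚ (map f (map suc (upTo M))) ≡ sumTo M f
Σℚ-range f M = trans (cong Σℚ (trans (sym (List.map-∘ (upTo M))) (List.map-upTo (λ i → f (suc i)) M)))
  (trans (Σℚ-applyUpTo (λ i → f (suc i)) M) (sumTo-cong M _ _ (λ { (suc i) _ _ → refl })))

Πℚ-applyUpTo-snoc : ∀ (h : ℕ → ℚ) n → Πℚ (applyUpTo h (suc n)) ≡ Πℚ (applyUpTo h n) * h n
Πℚ-applyUpTo-snoc h n = trans (cong Πℚ (sym (List.applyUpTo-∷ʳ h n))) (trans (Πℚ-++ (applyUpTo h n) [ h n ]) (cong (Πℚ (applyUpTo h n) *_) (*-identityʳ (h n))))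

Πℚ-falling : ∀ x m → Πℚ (map (λ j → x - ℕ→ℚ j) (upTo m)) ≡ falling x m
Πℚ-falling x m = trans (cong Πℚ (List.map-upTo (λ j → x - ℕ→ℚ j) m)) (go m)
  where
  go : ∀ m → Πℚ (applyUpTo (λ j → x - ℕ→ℚ j) m) ≡ falling x m
  go zero = refl
  go (suc m) = trans (Πℚ-applyUpTo-snoc (λ j → x - ℕ→ℚ j) m) (trans (cong (_* (x - ℕ→ℚ m)) (go m)) (sym (falling-snoc x m)))

Πℚ-poch : ∀ a m → Πℚ (map (λ j → a + ℕ→ℚ j) (upTo m)) ≡ sign m * falling (- a) m
Πℚ-poch a m = trans (cong Πℚ (List.map-upTo (λ j → a + ℕ→ℚ j) m)) (go m)
  where
  ring₀ : 1ℚ ≡ 1ℚ * 1ℚ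
  ring₀ = solve-∀ ringℚ
  ring : ∀ s f a j → s * f * (a + j) ≡ - s * (f * (- a - j))
  ring = solve-∀ ringℚ
  go : ∀ m → Πℚ (applyUpTo (λ j → a + ℕ→ℚ j) m) ≡ sign m * falling (- a) m
  go zero = ring₀
  go (suc m) = trans (Πℚ-applyUpTo-snoc (λ j → a + ℕ→ℚ j) m)
    (trans (cong (_* (a + ℕ→ℚ m)) (go m)) (trans (ring (sign m) (falling (- a) m) a (ℕ→ℚ m)) (cong (- sign m *_) (sym (falling-snoc (- a) m)))))

Πℚ-factorial : ∀ m → Πℚ (map (λ j → ℕ→ℚ (suc j)) (upTo m)) ≡ factorial m
Πℚ-factorial m = trans (cong Πℚ (List.map-upTo (λ j → ℕ→ℚ (suc j)) m)) (go m)
  where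
  go : ∀ m → Πℚ (applyUpTo (λ j → ℕ→ℚ (suc j)) m) ≡ factorial m
  go zero = refl
  go (suc m) = trans (Πℚ-applyUpTo-snoc (λ j → ℕ→ℚ (suc j)) m) (cong (_* ℕ→ℚ (suc m)) (go m))

-- F and G as products of transfer matrices

module Expansion (M : ℕ) (t : ℚ) (t+m≢0 : ∀ m → 1 ≤ m → m < suc M → t + ℕ→ℚ m ≢ 0ℚ) where

  open Transfer M t t+m≢0 public

  sumSubsetTuple : ℕ → (List Bool → List ℕ → ℚ) → ℚ
  sumSubsetTuple r Φ' = Σℚ (map (λ A → Σℚ (map (λ ns → Φ' A ns) (tuples N r))) (subsets r))

  sumSubsetTuple-cong : ∀ r (f g : List Bool → List ℕ → ℚ) → (∀ A ns → f A ns ≡ g A ns) → sumSubsetTuple r f ≡ sumSubsetTuple r g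
  sumSubsetTuple-cong r f g h = Σℚ-cong _ _ (subsets r) (λ A → Σℚ-cong _ _ (tuples N r) (λ ns → h A ns))

  sumSubsetTuple-* : ∀ r c (f : List Bool → List ℕ → ℚ) → sumSubsetTuple r (λ A ns → c * f A ns) ≡ c * sumSubsetTuple r f
  sumSubsetTuple-* r c f = trans (Σℚ-cong _ (λ A → c * Σℚ (map (λ ns → f A ns) (tuples N r))) (subsets r) (λ A → Σℚ-* c _ (tuples N r)))
    (Σℚ-* c _ (subsets r))

  sumSubsetTuple-suc : ∀ r (Φ' : List Bool → List ℕ → ℚ) → sumSubsetTuple (suc r) Φ' ≡ sumStates (λ b n → sumSubsetTuple r (λ A ns → Φ' (b ∷ A) (n ∷ ns)))
  sumSubsetTuple-suc r Φ' = begin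
    sumSubsetTuple (suc r) Φ'
      ≡⟨ Σℚ-concatMap _ (λ b → map (b ∷_) (subsets r)) (true ∷ false ∷ []) ⟩
    Σℚ (map (λ b → Σℚ (map (λ A → Σℚ (map (λ ns → Φ' A ns) (tuples N (suc r)))) (map (b ∷_) (subsets r)))) (true ∷ false ∷ []))
      ≡⟨ Σℚ-cong _ (λ b → sumTo M (λ n → sumSubsetTuple r (λ A ns → Φ' (b ∷ A) (n ∷ ns)))) (true ∷ false ∷ []) head-fixed ⟩
    Σℚ (map (λ b → sumTo M (λ n → sumSubsetTuple r (λ A ns → Φ' (b ∷ A) (n ∷ ns)))) (true ∷ false ∷ []))
      ≡⟨ ring (sumTo M (λ n → sumSubsetTuple r (λ A ns → Φ' (true ∷ A) (n ∷ ns)))) (sumTo M (λ n → sumSubsetTuple r (λ A ns → Φ' (false ∷ A) (n ∷ ns)))) ⟩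
    sumTo M (λ n → sumSubsetTuple r (λ A ns → Φ' (false ∷ A) (n ∷ ns))) + sumTo M (λ n → sumSubsetTuple r (λ A ns → Φ' (true ∷ A) (n ∷ ns)))
      ≡⟨ sym (sumTo-+ M _ _) ⟩
    sumStates (λ b n → sumSubsetTuple r (λ A ns → Φ' (b ∷ A) (n ∷ ns))) ∎
    where
    open ≡-Reasoning
    ring : ∀ a b → a + (b + 0ℚ) ≡ b + a
    ring = solve-∀ ringℚ
    R = map suc (upTo M)
    head-fixed : ∀ b → Σℚ (map (λ A → Σℚ (map (λ ns → Φ' A ns) (tuples N (suc r)))) (map (b ∷_) (subsets r)))
                ≡ sumTo M (λ n → sumSubsetTuple r (λ A ns → Φ' (b ∷ A) (n ∷ ns)))
    head-fixed b = begin
      Σℚ (map (λ A → Σℚ (map (λ ns → Φ' A ns) (tuples N (suc r)))) (map (b ∷_) (subsets r)))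
        ≡⟨ Σℚ-map-map _ (b ∷_) (subsets r) ⟩
      Σℚ (map (λ A → Σℚ (map (λ ns → Φ' (b ∷ A) ns) (tuples N (suc r)))) (subsets r))
        ≡⟨ Σℚ-cong _ (λ A → Σℚ (map (λ n → Σℚ (map (λ ns → Φ' (b ∷ A) (n ∷ ns)) (tuples N r))) R)) (subsets r)
             (λ A → trans (Σℚ-concatMap _ (λ n → map (n ∷_) (tuples N r)) R)
                          (Σℚ-cong _ _ R (λ n → Σℚ-map-map _ (n ∷_) (tuples N r)))) ⟩
      Σℚ (map (λ A → Σℚ (map (λ n → Σℚ (map (λ ns → Φ' (b ∷ A) (n ∷ ns)) (tuples N r))) R)) (subsets r))
        ≡⟨ Σℚ-swap (λ A n → Σℚ (map (λ ns → Φ' (b ∷ A) (n ∷ ns)) (tuples N r))) (subsets r) R ⟩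
      Σℚ (map (λ n → sumSubsetTuple r (λ A ns → Φ' (b ∷ A) (n ∷ ns))) R)
        ≡⟨ Σℚ-range _ M ⟩
      sumTo M (λ n → sumSubsetTuple r (λ A ns → Φ' (b ∷ A) (n ∷ ns))) ∎

  weightF : Bool → ℕ → ℕ → ℚ
  weightF a kᵢ nᵢ = if a then inv (ℕ→ℚ (N ∸ nᵢ) + t) ^ kᵢ else inv (ℕ→ℚ nᵢ) ^ kᵢ

  termF : List ℕ → List Bool → List ℕ → ℚ
  termF k A ns = sign (card A) * (if inSbar A ns then Πℚ (zip3 weightF A k ns) else 0ℚ)

  F-as-sum : ∀ k → F N k t ≡ sumSubsetTuple (length k) (termF k)
  F-as-sum k = Σℚ-cong (λ A → sign (card A) * Σℚ (map (λ ns → if inSbar A ns then Πℚ (zip3 weightF A k ns) else 0ℚ) (tuples N (length k))))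
                   (λ A → Σℚ (map (λ ns → termF k A ns) (tuples N (length k))))
                   (subsets (length k))
                   (λ A → sym (Σℚ-* (sign (card A)) (λ ns → if inSbar A ns then Πℚ (zip3 weightF A k ns) else 0ℚ) (tuples N (length k))))

  headF : List ℕ → Bool → ℕ → ℚ
  headF [] a n = 0ℚ
  headF (k ∷ ks) a n = sumSubsetTuple (length ks) (λ A ns → termF (k ∷ ks) (a ∷ A) (n ∷ ns))

  F-headF : ∀ k ks → F N (k ∷ ks) t ≡ sumStates (headF (k ∷ ks))
  F-headF k ks = trans (F-as-sum (k ∷ ks)) (sumSubsetTuple-suc (length ks) (termF (k ∷ ks)))

  sign-cons : ∀ a A → sign (card (a ∷ A)) ≡ sg a * sign (card A)
  sign-cons true A = ring (sign (card A))
    where ring : ∀ x → - x ≡ - 1ℚ * x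
          ring = solve-∀ ringℚ
  sign-cons false A = ring (sign (card A))
    where ring : ∀ x → x ≡ 1ℚ * x
          ring = solve-∀ ringℚ

  weightF≡W^ : ∀ a k n → weightF a k n ≡ W a n ^ k
  weightF≡W^ true k n = refl
  weightF≡W^ false k n = refl

  headF-single : ∀ k a n → headF (k ∷ []) a n ≡ sg a * W a n ^ k
  headF-single k a n = trans (ring (termF (k ∷ []) (a ∷ []) (n ∷ [])))
    (trans (cong₂ (λ s z → s * (z * 1ℚ)) (sign-cons a []) (weightF≡W^ a k n)) (ring₂ (sg a) (W a n ^ k)))
    where
    ring : ∀ x → (x + 0ℚ) + 0ℚ ≡ x
    ring = solve-∀ ringℚ
    ring₂ : ∀ s w → s * 1ℚ * (w * 1ℚ) ≡ s * w
    ring₂ = solve-∀ ringℚ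

  termF-cons-if : ∀ (cb d : Bool) (sa s w y : ℚ) → (sa * s) * (if cb ∧ d then w * y else 0ℚ) ≡ (sa * w) * (ind cb * (s * (if d then y else 0ℚ)))
  termF-cons-if true true sa s w y = ring sa s w y
    where ring : ∀ sa s w y → (sa * s) * (w * y) ≡ (sa * w) * (1ℚ * (s * y))
          ring = solve-∀ ringℚ
  termF-cons-if true false sa s w y = ring sa s w
    where ring : ∀ sa s w → (sa * s) * 0ℚ ≡ (sa * w) * (1ℚ * (s * 0ℚ))
          ring = solve-∀ ringℚ
  termF-cons-if false d sa s w y = ring sa s w (if d then y else 0ℚ)
    where ring : ∀ sa s w z → (sa * s) * 0ℚ ≡ (sa * w) * (0ℚ * (s * z))
          ring = solve-∀ ringℚ

  termF-cons : ∀ k₁ k' a b n n' A ns →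
    termF (k₁ ∷ k') (a ∷ b ∷ A) (n ∷ n' ∷ ns) ≡ (sg a * W a n ^ k₁) * (ind (okF b n n') * termF k' (b ∷ A) (n' ∷ ns))
  termF-cons k₁ k' a b n n' A ns = trans
    (cong₂ (λ s z → s * (if okF b n n' ∧ inSbar (b ∷ A) (n' ∷ ns) then z * Πℚ (zip3 weightF (b ∷ A) k' (n' ∷ ns)) else 0ℚ)) (sign-cons a (b ∷ A)) (weightF≡W^ a k₁ n))
    (termF-cons-if (okF b n n') (inSbar (b ∷ A) (n' ∷ ns)) (sg a) (sign (card (b ∷ A))) (W a n ^ k₁) (Πℚ (zip3 weightF (b ∷ A) k' (n' ∷ ns))))

  headF-cons : ∀ k₁ k₂ ks a n → headF (k₁ ∷ k₂ ∷ ks) a n ≡ sg a * W a n ^ k₁ * sumStates (λ b n' → ind (okF b n n') * headF (k₂ ∷ ks) b n')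
  headF-cons k₁ k₂ ks a n = begin
    sumSubsetTuple (suc (length ks)) (λ A ns → termF (k₁ ∷ k₂ ∷ ks) (a ∷ A) (n ∷ ns))
      ≡⟨ sumSubsetTuple-suc (length ks) (λ A ns → termF (k₁ ∷ k₂ ∷ ks) (a ∷ A) (n ∷ ns)) ⟩
    sumStates (λ b n' → sumSubsetTuple (length ks) (λ A ns → termF (k₁ ∷ k₂ ∷ ks) (a ∷ b ∷ A) (n ∷ n' ∷ ns)))
      ≡⟨ sumStates-cong (λ b n' → sumSubsetTuple (length ks) (λ A ns → termF (k₁ ∷ k₂ ∷ ks) (a ∷ b ∷ A) (n ∷ n' ∷ ns)))
                 (λ b n' → c * (ind (okF b n n') * headF (k₂ ∷ ks) b n'))
                 (λ b n' _ _ → trans (sumSubsetTuple-cong (length ks) _ (λ A ns → c * (ind (okF b n n') * termF (k₂ ∷ ks) (b ∷ A) (n' ∷ ns)))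
                                        (λ A ns → termF-cons k₁ (k₂ ∷ ks) a b n n' A ns))
                                     (trans (sumSubsetTuple-* (length ks) c (λ A ns → ind (okF b n n') * termF (k₂ ∷ ks) (b ∷ A) (n' ∷ ns)))
                                            (cong (c *_) (sumSubsetTuple-* (length ks) (ind (okF b n n')) (λ A ns → termF (k₂ ∷ ks) (b ∷ A) (n' ∷ ns)))))) ⟩
    sumStates (λ b n' → c * (ind (okF b n n') * headF (k₂ ∷ ks) b n'))
      ≡⟨ sumStates-* c (λ b n' → ind (okF b n n') * headF (k₂ ∷ ks) b n') ⟩
    c * sumStates (λ b n' → ind (okF b n n') * headF (k₂ ∷ ks) b n') ∎
    where
    open ≡-Reasoning
    c = sg a * W a n ^ k₁

  suffixF-replicate : ∀ j rest a n → suffixF (replicate j true ++ rest) a n ≡ W a n ^ j * suffixF rest a n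
  suffixF-replicate zero rest a n = sym (*-identityˡ (suffixF rest a n))
  suffixF-replicate (suc j) rest a n = trans (cong (W a n *_) (suffixF-replicate j rest a n)) (ring (W a n) (W a n ^ j) (suffixF rest a n))
    where ring : ∀ w p f → w * (p * f) ≡ (w * p) * f
          ring = solve-∀ ringℚ

  headF-boxes : ∀ k ks → All (1 ≤_) (k ∷ ks) → ∀ a n → headF (k ∷ ks) a n ≡ sg a * W a n * suffixF (toBoxes (k ∷ ks)) a n
  headF-boxes zero ks (() ∷ _) a n
  headF-boxes (suc k) [] _ a n = begin
    headF (suc k ∷ []) a n
      ≡⟨ headF-single (suc k) a n ⟩
    sg a * (W a n * W a n ^ k)
      ≡⟨ ring (sg a) (W a n) (W a n ^ k) ⟩
    sg a * W a n * (W a n ^ k * 1ℚ)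
      ≡⟨ cong (sg a * W a n *_) (sym (trans (cong (λ z → suffixF z a n) (sym (List.++-identityʳ (replicate k true)))) (suffixF-replicate k [] a n))) ⟩
    sg a * W a n * suffixF (replicate k true) a n ∎
    where
    open ≡-Reasoning
    ring : ∀ s w p → s * (w * p) ≡ s * w * (p * 1ℚ)
    ring = solve-∀ ringℚ
  headF-boxes (suc k) (k₂ ∷ ks) (_ ∷ ps) a n = begin
    headF (suc k ∷ k₂ ∷ ks) a n
      ≡⟨ headF-cons (suc k) k₂ ks a n ⟩
    sg a * (W a n * W a n ^ k) * sumStates (λ b n' → ind (okF b n n') * headF (k₂ ∷ ks) b n')
      ≡⟨ cong (sg a * (W a n * W a n ^ k) *_)
           (sumStates-cong (λ b n' → ind (okF b n n') * headF (k₂ ∷ ks) b n') (λ b n' → (ind (okF b n n') * (sg b * W b n')) * suffixF T b n')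
                    (λ b n' _ _ → trans (cong (ind (okF b n n') *_) (headF-boxes k₂ ks ps b n')) (ring₁ (ind (okF b n n')) (sg b) (W b n') (suffixF T b n')))) ⟩
    sg a * (W a n * W a n ^ k) * suffixF (false ∷ T) a n
      ≡⟨ ring₂ (sg a) (W a n) (W a n ^ k) (suffixF (false ∷ T) a n) ⟩
    sg a * W a n * (W a n ^ k * suffixF (false ∷ T) a n)
      ≡⟨ cong (sg a * W a n *_) (sym (suffixF-replicate k (false ∷ T) a n)) ⟩
    sg a * W a n * suffixF (replicate k true ++ (false ∷ T)) a n ∎
    where
    open ≡-Reasoning
    T = toBoxes (k₂ ∷ ks)
    ring₁ : ∀ i s w f → i * (s * w * f) ≡ (i * (s * w)) * f
    ring₁ = solve-∀ ringℚ
    ring₂ : ∀ s w p f → s * (w * p) * f ≡ s * w * (p * f)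
    ring₂ = solve-∀ ringℚ

  inv-pow : ∀ m l → 1 ≤ m → inv (ℕ→ℚ m ^ l) ≡ W₀ m ^ l
  inv-pow (suc m) l _ = inv-^ (ℕ→ℚ (suc m)) l (ℕ→ℚ-suc≢0 m)

  tailG : ℕ → ℚ
  tailG n = sign (n ∸ 1) * binom t n * (poch (1ℚ - ℕ→ℚ N) n * inv (poch (1ℚ - ℕ→ℚ N - t) n))

  negN : - (1ℚ - ℕ→ℚ N) ≡ ℕ→ℚ M
  negN = trans (cong (λ z → - (1ℚ - z)) (ℕ→ℚ-suc M)) (ring (ℕ→ℚ M))
    where ring : ∀ a → - (1ℚ - (1ℚ + a)) ≡ a
          ring = solve-∀ ringℚ

  negNt : - (1ℚ - ℕ→ℚ N - t) ≡ u
  negNt = trans (cong (λ z → - (1ℚ - z - t)) (ℕ→ℚ-suc M)) (ring (ℕ→ℚ M) t)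
    where ring : ∀ a t → - (1ℚ - (1ℚ + a) - t) ≡ a + t
          ring = solve-∀ ringℚ

  uM : u - ℕ→ℚ M ≡ t
  uM = ring (ℕ→ℚ M) t
    where ring : ∀ a t → a + t - a ≡ t
          ring = solve-∀ ringℚ

  tailG≡Φ : ∀ m → 1 ≤ m → m ≤ M → tailG m ≡ Φ (ℕ→ℚ M) m
  tailG≡Φ (suc j) _ m≤M = begin
    sign j * (Πℚ (map (λ i → t - ℕ→ℚ i) (upTo m)) * inv (factorialℚ m)) * (poch (1ℚ - ℕ→ℚ N) m * inv (poch (1ℚ - ℕ→ℚ N - t) m))
      ≡⟨ cong₂ (λ y z → sign j * (y * inv z) * (poch (1ℚ - ℕ→ℚ N) m * inv (poch (1ℚ - ℕ→ℚ N - t) m))) (Πℚ-falling t m) (Πℚ-factorial m) ⟩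
    sign j * (falling t m * inv (factorial m)) * (poch (1ℚ - ℕ→ℚ N) m * inv (poch (1ℚ - ℕ→ℚ N - t) m))
      ≡⟨ cong₂ (λ y z → sign j * (falling t m * inv (factorial m)) * (y * inv z))
           (trans (Πℚ-poch (1ℚ - ℕ→ℚ N) m) (cong (λ x → sign m * falling x m) negN))
           (trans (Πℚ-poch (1ℚ - ℕ→ℚ N - t) m) (cong (λ x → sign m * falling x m) negNt)) ⟩
    sign j * (falling t m * inv (factorial m)) * ((sign m * falling (ℕ→ℚ M) m) * inv (sign m * falling u m))
      ≡⟨ cong (λ z → sign j * (falling t m * inv (factorial m)) * ((sign m * falling (ℕ→ℚ M) m) * z)) (trans (inv-distrib-* (sign m) (falling u m) (sign≢0 m) (falling-u≢0 m m≤M)) (cong (_* inv (falling u m)) (inv-sign m))) ⟩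
    sign j * (falling t m * inv (factorial m)) * ((sign m * falling (ℕ→ℚ M) m) * (sign m * inv (falling u m)))
      ≡⟨ at-unit₁ (λ p → sign j * (falling (ℕ→ℚ M) m * falling t m) * (inv (factorial m) * inv (falling u m)) * p)
           (ring (sign j) (falling t m) (inv (factorial m)) (sign m) (falling (ℕ→ℚ M) m) (inv (falling u m))) (sign-sq m)
           (*-identityʳ (sign j * (falling (ℕ→ℚ M) m * falling t m) * (inv (factorial m) * inv (falling u m)))) ⟩
    sign j * (falling (ℕ→ℚ M) m * falling t m) * (inv (factorial m) * inv (falling u m))
      ≡⟨ cong (λ x → sign j * (falling (ℕ→ℚ M) m * falling x m) * (inv (factorial m) * inv (falling u m))) (sym uM) ⟩
    Φ (ℕ→ℚ M) m ∎
    where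
    open ≡-Reasoning
    m = suc j
    ring : ∀ s T I σ F U → s * (T * I) * ((σ * F) * (σ * U)) ≡ s * (F * T) * (I * U) * (σ * σ)
    ring = solve-∀ ringℚ

  weightG : Bool → ℕ → ℕ → ℚ
  weightG a kᵢ nᵢ = if a then inv (ℕ→ℚ (N ∸ nᵢ) + t) else inv (ℕ→ℚ nᵢ ^ kᵢ)

  termG : List ℕ → List Bool → List ℕ → ℚ
  termG l A ns = if admissible A l then (if inSstar A ns then Πℚ (zip3 weightG A l ns) * tailG (last ns) else 0ℚ) else 0ℚ

  G-as-sum : ∀ l → G N l t ≡ sumSubsetTuple (length l) (termG l)
  G-as-sum l = Σℚ-cong (λ A → if admissible A l then Σℚ (map (λ ns → if inSstar A ns then Πℚ (zip3 weightG A l ns) * tailG (last ns) else 0ℚ) (tuples N (length l))) else 0ℚ)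
                   (λ A → Σℚ (map (λ ns → termG l A ns) (tuples N (length l))))
                   (subsets (length l))
                   (λ A → Σℚ-if (admissible A l) (λ ns → if inSstar A ns then Πℚ (zip3 weightG A l ns) * tailG (last ns) else 0ℚ) (tuples N (length l)))

  headG : List ℕ → Bool → ℕ → ℚ
  headG [] a m = 0ℚ
  headG (l ∷ ls) a m = sumSubsetTuple (length ls) (λ A ns → termG (l ∷ ls) (a ∷ A) (m ∷ ns))

  G-headG : ∀ L → ∃₂ (λ l ls → L ≡ l ∷ ls) → G N L t ≡ sumStates (headG L)
  G-headG .(l ∷ ls) (l , ls , refl) = trans (G-as-sum (l ∷ ls)) (sumSubsetTuple-suc (length ls) (termG (l ∷ ls)))

  headG-single : ∀ l a m → headG (l ∷ []) a m ≡ (if a then 0ℚ else inv (ℕ→ℚ m ^ l) * tailG m)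
  headG-single l true m = ring₀
    where ring₀ : (0ℚ + 0ℚ) + 0ℚ ≡ 0ℚ
          ring₀ = solve-∀ ringℚ
  headG-single l false m = ring₁ (inv (ℕ→ℚ m ^ l)) (tailG m)
    where ring₁ : ∀ a b → ((a * 1ℚ) * b + 0ℚ) + 0ℚ ≡ a * b
          ring₁ = solve-∀ ringℚ

  admissibleAt : Bool → ℕ → Bool
  admissibleAt a l = if a then l ≡ᵇ 1 else true

  termG-cons-if : ∀ (c d e f : Bool) (g y z : ℚ) →
    (if c ∧ d then (if e ∧ f then (g * y) * z else 0ℚ) else 0ℚ) ≡ (ind c * g) * (ind e * (if d then (if f then y * z else 0ℚ) else 0ℚ))
  termG-cons-if false d e f g y z = ring g (if d then (if f then y * z else 0ℚ) else 0ℚ) (ind e)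
    where ring : ∀ g X i → 0ℚ ≡ (0ℚ * g) * (i * X)
          ring = solve-∀ ringℚ
  termG-cons-if true false e f g y z = ring g (ind e)
    where ring : ∀ g i → 0ℚ ≡ (1ℚ * g) * (i * 0ℚ)
          ring = solve-∀ ringℚ
  termG-cons-if true true false f g y z = ring g (if f then y * z else 0ℚ)
    where ring : ∀ g X → 0ℚ ≡ (1ℚ * g) * (0ℚ * X)
          ring = solve-∀ ringℚ
  termG-cons-if true true true true g y z = ring g y z
    where ring : ∀ g y z → (g * y) * z ≡ (1ℚ * g) * (1ℚ * (y * z))
          ring = solve-∀ ringℚ
  termG-cons-if true true true false g y z = ring g
    where ring : ∀ g → 0ℚ ≡ (1ℚ * g) * (1ℚ * 0ℚ)
          ring = solve-∀ ringℚ

  termG-cons : ∀ l₁ l' a b m m' A ns →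
    termG (l₁ ∷ l') (a ∷ b ∷ A) (m ∷ m' ∷ ns) ≡ (ind (admissibleAt a l₁) * weightG a l₁ m) * (ind (okG a b m m') * termG l' (b ∷ A) (m' ∷ ns))
  termG-cons l₁ l' a b m m' A ns = termG-cons-if (admissibleAt a l₁) (admissible (b ∷ A) l') (okG a b m m') (inSstar (b ∷ A) (m' ∷ ns))
    (weightG a l₁ m) (Πℚ (zip3 weightG (b ∷ A) l' (m' ∷ ns))) (tailG (last (m' ∷ ns)))

  headG-cons : ∀ l₁ L → ∃₂ (λ l ls → L ≡ l ∷ ls) → ∀ a m →
    headG (l₁ ∷ L) a m ≡ ind (admissibleAt a l₁) * weightG a l₁ m * sumStates (λ b m' → ind (okG a b m m') * headG L b m')
  headG-cons l₁ .(l₂ ∷ ls) (l₂ , ls , refl) a m = begin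
    sumSubsetTuple (suc (length ls)) (λ A ns → termG (l₁ ∷ l₂ ∷ ls) (a ∷ A) (m ∷ ns))
      ≡⟨ sumSubsetTuple-suc (length ls) (λ A ns → termG (l₁ ∷ l₂ ∷ ls) (a ∷ A) (m ∷ ns)) ⟩
    sumStates (λ b m' → sumSubsetTuple (length ls) (λ A ns → termG (l₁ ∷ l₂ ∷ ls) (a ∷ b ∷ A) (m ∷ m' ∷ ns)))
      ≡⟨ sumStates-cong (λ b m' → sumSubsetTuple (length ls) (λ A ns → termG (l₁ ∷ l₂ ∷ ls) (a ∷ b ∷ A) (m ∷ m' ∷ ns)))
                 (λ b m' → c * (ind (okG a b m m') * headG (l₂ ∷ ls) b m'))
                 (λ b m' _ _ → trans (sumSubsetTuple-cong (length ls) _ (λ A ns → c * (ind (okG a b m m') * termG (l₂ ∷ ls) (b ∷ A) (m' ∷ ns)))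
                                        (λ A ns → termG-cons l₁ (l₂ ∷ ls) a b m m' A ns))
                                     (trans (sumSubsetTuple-* (length ls) c (λ A ns → ind (okG a b m m') * termG (l₂ ∷ ls) (b ∷ A) (m' ∷ ns)))
                                            (cong (c *_) (sumSubsetTuple-* (length ls) (ind (okG a b m m')) (λ A ns → termG (l₂ ∷ ls) (b ∷ A) (m' ∷ ns)))))) ⟩
    sumStates (λ b m' → c * (ind (okG a b m m') * headG (l₂ ∷ ls) b m'))
      ≡⟨ sumStates-* c (λ b m' → ind (okG a b m m') * headG (l₂ ∷ ls) b m') ⟩
    c * sumStates (λ b m' → ind (okG a b m m') * headG (l₂ ∷ ls) b m') ∎
    where
    open ≡-Reasoning
    c = ind (admissibleAt a l₁) * weightG a l₁ m

  fromBoxes-nonempty : ∀ c bs → ∃₂ (λ l ls → fromBoxes c bs ≡ l ∷ ls)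
  fromBoxes-nonempty c [] = c , [] , refl
  fromBoxes-nonempty c (true ∷ bs) = fromBoxes-nonempty (suc c) bs
  fromBoxes-nonempty c (false ∷ bs) = c , fromBoxes 1 bs , refl

  headWeightG : ℕ → Bool → ℕ → ℚ
  headWeightG c false m = W₀ m ^ suc c
  headWeightG zero true m = W₁ m
  headWeightG (suc c) true m = 0ℚ

  headWeightG-0 : ∀ b m → headWeightG 0 b m ≡ W b m
  headWeightG-0 false m = *-identityʳ (W₀ m)
  headWeightG-0 true m = refl

  headWeightG-prefix : ∀ c a m → 1 ≤ m → ind (admissibleAt a (suc c)) * weightG a (suc c) m ≡ headWeightG c a m
  headWeightG-prefix c false m p = trans (*-identityˡ (inv (ℕ→ℚ m ^ suc c))) (inv-pow m (suc c) p)
  headWeightG-prefix zero true m p = *-identityˡ (W₁ m)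
  headWeightG-prefix (suc c) true m p = *-zeroˡ (W₁ m)

  headG-boxes : ∀ bs c a m → 1 ≤ m → m ≤ M → headG (fromBoxes (suc c) bs) a m ≡ headWeightG c a m * suffixG bs a m
  headG-boxes [] c true m p q = trans (headG-single (suc c) true m) (ring (headWeightG c true m))
    where ring : ∀ x → 0ℚ ≡ x * 0ℚ
          ring = solve-∀ ringℚ
  headG-boxes [] c false m p q = trans (headG-single (suc c) false m) (cong₂ _*_ (inv-pow m (suc c) p) (tailG≡Φ m p q))
  headG-boxes (true ∷ bs) c false m p q = trans (headG-boxes bs (suc c) false m p q) (ring (W₀ m) (W₀ m ^ c) (suffixG bs false m))
    where ring : ∀ w p g → (w * (w * p)) * g ≡ (w * p) * (w * g)
          ring = solve-∀ ringℚ
  headG-boxes (true ∷ bs) c true m p q = trans (headG-boxes bs (suc c) true m p q) (ring (suffixG bs true m) (headWeightG c true m))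
    where ring : ∀ g x → 0ℚ * g ≡ x * 0ℚ
          ring = solve-∀ ringℚ
  headG-boxes (false ∷ bs) c a m p q = begin
    headG (suc c ∷ fromBoxes 1 bs) a m
      ≡⟨ headG-cons (suc c) (fromBoxes 1 bs) (fromBoxes-nonempty 1 bs) a m ⟩
    ind (admissibleAt a (suc c)) * weightG a (suc c) m * sumStates (λ b m' → ind (okG a b m m') * headG (fromBoxes 1 bs) b m')
      ≡⟨ cong₂ _*_ (headWeightG-prefix c a m p)
           (sumStates-cong (λ b m' → ind (okG a b m m') * headG (fromBoxes 1 bs) b m') (λ b m' → (ind (okG a b m m') * W b m') * suffixG bs b m')
                    (λ b m' p' q' → trans (cong (ind (okG a b m m') *_) (trans (headG-boxes bs 0 b m' p' q') (cong (_* suffixG bs b m') (headWeightG-0 b m'))))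
                                          (ring (ind (okG a b m m')) (W b m') (suffixG bs b m')))) ⟩
    headWeightG c a m * suffixG (false ∷ bs) a m ∎
    where
    open ≡-Reasoning
    ring : ∀ i w g → i * (w * g) ≡ (i * w) * g
    ring = solve-∀ ringℚ

  G≡walkG : ∀ bs → G N (fromBoxes 1 bs) t ≡ walkG bs
  G≡walkG bs = trans (G-headG (fromBoxes 1 bs) (fromBoxes-nonempty 1 bs))
    (sumStates-cong (headG (fromBoxes 1 bs)) (λ a m → W a m * suffixG bs a m)
      (λ a m 1≤m m≤M → trans (headG-boxes bs 0 a m 1≤m m≤M) (cong (_* suffixG bs a m) (headWeightG-0 a m))))

  F≡walkF : ∀ k ks → All (1 ≤_) (k ∷ ks) → F N (k ∷ ks) t ≡ walkF (toBoxes (k ∷ ks))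
  F≡walkF k ks k≥1 = trans (F-headF k ks)
    (sumStates-cong (headF (k ∷ ks)) (λ a n → sg a * W a n * suffixF (toBoxes (k ∷ ks)) a n) (λ a n _ _ → headF-boxes k ks k≥1 a n))

theorem5p8 : (N : ℕ) → 1 ≤ N → (k₁ : ℕ) (ks : List ℕ) → All (1 ≤_) (k₁ ∷ ks) →
    (t : ℚ) → (∀ (m : ℕ) → 1 ≤ m → m < N → t + ℕ→ℚ m ≢ 0ℚ) →
    F N (k₁ ∷ ks) t ≡ G N (dual (k₁ ∷ ks)) t
theorem5p8 (suc M) (s≤s z≤n) k₁ ks k≥1 t t+m≢0 = begin
  F (suc M) k t                    ≡⟨ F≡walkF k₁ ks k≥1 ⟩
  walkF (toBoxes k)                ≡⟨ walk-duality (toBoxes k) ⟩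
  walkG (map not (toBoxes k))      ≡⟨ sym (G≡walkG (map not (toBoxes k))) ⟩
  G (suc M) (dual k) t             ∎
  where
  open ≡-Reasoning
  open Expansion M t t+m≢0
  k = k₁ ∷ ks
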